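{- For every integer $n\ge 1$, $$\sum_{\pi\in \mathcal I^C_{2n}(321)}q^{\mathrm{maj}^+(\pi)}=\sum_{h=0}^{n} \binom{n}{h}_q+(q^n-1)\sum_{h=0}^{n-1} \binom{n-1}{h}_q=\sum_{h=0}^{n} q^{n-h}\binom{n}{h}_q,$$ where $\binom{n}{h}_q$ denotes the $q$-binomial coefficient.
   Context: A permutation $\pi\in\mathcal S_m$ is centrosymmetric if $\pi(i)+\pi(m+1-i)=m+1$ for all $1\le i\le m$. $\mathcal I^C_m(321)$ denotes the set of centrosymmetric involutions in $\mathcal S_m$ that avoid the pattern $321$ (i.e., contain no indices $i<j<k$ with $\pi(i)>\pi(j)>\pi(k)$). The descent set of $\pi\in\mathcal S_m$ is $\mathrm{Des}(\pi)=\{i\in[m-1]:\pi(i)>\pi(i+1)\}$. For $\pi\in\mathcal S_m$ with $n=\lfloor m/2\rfloor$, $\mathrm{Des}^+(\pi)=\mathrm{Des}(\pi)\cap[n]$ where $[n]=\{1,\dots,n\}$, and $\mathrm{maj}^+(\pi)=\sum_{i\in\mathrm{Des}^+(\pi)}i$. -}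

module Defs where

open import Data.Nat as ℕ using (ℕ; zero; suc; _+_)
open import Data.Integer as ℤ using (ℤ; 1ℤ; 0ℤ)
open import Data.Fin as Fin using (Fin; toℕ; opposite)
open import Data.Fin.Properties using (all?; any?; _≟_)
open import Data.Vec using (Vec; []; _∷_; lookup)
open import Data.List as List using (List; []; _∷_; [_]; map; concatMap; filter; allFin)
open import Data.Nat.ListAction using (sum)
open import Data.Product using (Σ; _×_; _,_)
open import Relation.Nullary using (¬_; Dec)
open import Relation.Nullary.Decidable using (_×-dec_; ¬?)
open import Relation.Binary.PropositionalEquality using (_≡_)

-- A map [m] → [m] is encoded 0-based as a vector π with π(i) = lookup π i.
Map : ℕ → Set
Map m = Vec (Fin m) m

allVecs : (k m : ℕ) → List (Vec (Fin m) k)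
allVecs zero    m = [ [] ]
allVecs (suc k) m = concatMap (λ i → map (i ∷_) (allVecs k m)) (allFin m)

IsPerm : ∀ {m} → Map m → Set
IsPerm π = ∀ i j → lookup π i ≡ lookup π j → i ≡ j

IsInvolution : ∀ {m} → Map m → Set
IsInvolution π = ∀ i → lookup π (lookup π i) ≡ i

-- π(i) + π(m+1-i) = m+1 (1-based) ⇔ π(opposite i) = opposite (π i) (0-based)
IsCentrosymmetric : ∀ {m} → Map m → Set
IsCentrosymmetric π = ∀ i → lookup π (opposite i) ≡ opposite (lookup π i)

Avoids321 : ∀ {m} → Map m → Set
Avoids321 π = ∀ i j k →
  ¬ ((i Fin.< j) × (j Fin.< k) × (lookup π j Fin.< lookup π i) × (lookup π k Fin.< lookup π j))

IsCInv321 : ∀ {m} → Map m → Set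
IsCInv321 π = IsPerm π × IsInvolution π × IsCentrosymmetric π × Avoids321 π

isCInv321? : ∀ {m} (π : Map m) → Dec (IsCInv321 π)
isCInv321? π =
  all? (λ i → all? (λ j → Dec-→ (lookup π i ≟ lookup π j) (i ≟ j)))
  ×-dec all? (λ i → lookup π (lookup π i) ≟ i)
  ×-dec all? (λ i → lookup π (opposite i) ≟ opposite (lookup π i))
  ×-dec all? (λ i → all? (λ j → all? (λ k →
          ¬? ((i Fin.<? j) ×-dec (j Fin.<? k) ×-dec (lookup π j Fin.<? lookup π i)
              ×-dec (lookup π k Fin.<? lookup π j)))))
  where
  open import Relation.Nullary.Decidable using () renaming (_→-dec_ to Dec-→)

CInv321 : (m : ℕ) → List (Map m)
CInv321 m = filter isCInv321? (allVecs m m)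

-- i ∈ Des(π) for i a 1-based position: π(i) > π(i+1)
IsDescent : ∀ {m} → Map m → ℕ → Set
IsDescent {m} π i = Σ (Fin m) λ a → Σ (Fin m) λ b →
  (toℕ a + 1 ≡ i) × (toℕ b ≡ i) × (lookup π b Fin.< lookup π a)

isDescent? : ∀ {m} (π : Map m) (i : ℕ) → Dec (IsDescent π i)
isDescent? π i = any? (λ a → any? (λ b →
  (toℕ a + 1 ℕ.≟ i) ×-dec (toℕ b ℕ.≟ i) ×-dec (lookup π b Fin.<? lookup π a)))

range1 : ℕ → List ℕ
range1 n = List.map suc (List.upTo n)

maj⁺ : ∀ {m} → Map m → ℕ
maj⁺ {m} π = sum (filter (isDescent? π) (range1 (m ℕ./ 2)))

Σ[0to_] : ℕ → (ℕ → ℤ) → ℤ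
Σ[0to n ] f = List.foldr ℤ._+_ 0ℤ (List.map f (List.upTo (suc n)))

qbinom : ℤ → ℕ → ℕ → ℤ
qbinom q zero    zero    = 1ℤ
qbinom q zero    (suc k) = 0ℤ
qbinom q (suc n) zero    = 1ℤ
qbinom q (suc n) (suc k) = qbinom q n k ℤ.+ (q ℤ.^ suc k) ℤ.* qbinom q n (suc k)

-- An involution that avoids 321 is determined by its openers (the i with i < π(i)): it matches
-- the k-th opener with the k-th closer, so it is the arc diagram of a Motzkin path whose flat
-- steps lie on the ground. If π is also centrosymmetric in S_2n, this path is the mirror image
-- of its first half, and that half is encoded by an arbitrary word c ∈ {0,1}^n: climb at the 1s,
-- descend at the 0s, and stay flat on the ground when no descent is possible. A descent of π at
-- i ≤ n is then exactly a factor 10 of c at positions i, i + 1 (with c_{n+1} = 0). Splitting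
-- words by their last letter, the generating function W_n of maj⁺ and the variant Z_n that
-- ignores the descent at n satisfy W_{n+1} = W_n + q^{n+1} Z_n and Z_{n+1} = Z_n + W_n. By the
-- two q-Pascal rules the sums Σ_h q^{n-h} [n,h]_q and Σ_h [n,h]_q obey the same recursion, which
-- also yields the second identity.

module Submission where

open import Data.Integer using (ℤ)

module Sums where

  open import Defs using (Σ[0to_])
  open import Data.Nat using (ℕ; zero; suc; _<_; z≤n; s≤s)
  open import Data.Integer using (ℤ; _+_; _*_; 0ℤ)
  import Data.Integer.Properties as ℤ
  open import Data.Integer.Tactic.RingSolver using (solve-∀)
  open import Data.List using (List; []; _∷_; map; foldr; applyUpTo; _++_)
  open import Data.List.Properties using (map-∘)
  open import Data.List.Membership.Propositional using (_∈_)
  open import Data.List.Membership.Propositional.Properties using (∈-map⁺; ∈-map⁻)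
  open import Data.List.Membership.Propositional.Properties.WithK using (unique∧set⇒bag)
  open import Data.List.Relation.Binary.BagAndSetEquality using (∼bag⇒↭)
  open import Data.List.Relation.Binary.Permutation.Propositional using (_↭_; ↭⇒↭ₛ)
  import Data.List.Relation.Binary.Permutation.Propositional.Properties as Perm
  open import Data.List.Relation.Binary.Permutation.Setoid.Properties using (foldr-commMonoid)
  open import Data.List.Relation.Unary.Unique.Propositional using (Unique)
  import Data.List.Relation.Unary.Unique.Propositional.Properties as Unique
  open import Data.Product using (_,_)
  open import Function using (_∘_; id; mk⇔)
  open import Relation.Binary.PropositionalEquality
  open ≡-Reasoning

  ∑< : ℕ → (ℕ → ℤ) → ℤ
  ∑< zero    f = 0ℤ
  ∑< (suc k) f = f 0 + ∑< k (f ∘ suc)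

  foldr-map-applyUpTo : ∀ (f : ℕ → ℤ) g k →
    foldr _+_ 0ℤ (map f (applyUpTo g k)) ≡ ∑< k (f ∘ g)
  foldr-map-applyUpTo f g zero    = refl
  foldr-map-applyUpTo f g (suc k) = cong (f (g 0) +_) (foldr-map-applyUpTo f (g ∘ suc) k)

  Σ[0to]≡∑< : ∀ n f → Σ[0to n ] f ≡ ∑< (suc n) f
  Σ[0to]≡∑< n f = foldr-map-applyUpTo f id (suc n)

  ∑<-cong : ∀ {f g} k → (∀ h → h < k → f h ≡ g h) → ∑< k f ≡ ∑< k g
  ∑<-cong zero    f≡g = refl
  ∑<-cong (suc k) f≡g = cong₂ _+_ (f≡g 0 (s≤s z≤n)) (∑<-cong k (λ h h<k → f≡g (suc h) (s≤s h<k)))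

  ∑<-+ : ∀ f g k → ∑< k (λ h → f h + g h) ≡ ∑< k f + ∑< k g
  ∑<-+ f g zero    = refl
  ∑<-+ f g (suc k) = begin
    f 0 + g 0 + ∑< k (λ h → f (suc h) + g (suc h))   ≡⟨ cong (f 0 + g 0 +_) (∑<-+ (f ∘ suc) (g ∘ suc) k) ⟩
    f 0 + g 0 + (∑< k (f ∘ suc) + ∑< k (g ∘ suc))   ≡⟨ interchange (f 0) (g 0) (∑< k (f ∘ suc)) (∑< k (g ∘ suc)) ⟩
    f 0 + ∑< k (f ∘ suc) + (g 0 + ∑< k (g ∘ suc))   ∎
    where
    interchange : ∀ a b c d → a + b + (c + d) ≡ a + c + (b + d)
    interchange = solve-∀

  ∑<-*ˡ : ∀ c f k → ∑< k (λ h → c * f h) ≡ c * ∑< k f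
  ∑<-*ˡ c f zero    = sym (ℤ.*-zeroʳ c)
  ∑<-*ˡ c f (suc k) = trans (cong (c * f 0 +_) (∑<-*ˡ c (f ∘ suc) k)) (distrib c (f 0) _)
    where
    distrib : ∀ a b d → a * b + a * d ≡ a * (b + d)
    distrib = solve-∀

  ∑<-suc : ∀ f k → ∑< (suc k) f ≡ ∑< k f + f k
  ∑<-suc f zero    = trans (ℤ.+-identityʳ (f 0)) (sym (ℤ.+-identityˡ (f 0)))
  ∑<-suc f (suc k) = trans (cong (f 0 +_) (∑<-suc (f ∘ suc) k)) (sym (ℤ.+-assoc (f 0) _ _))

  sumℤ : List ℤ → ℤ
  sumℤ = foldr _+_ 0ℤ

  sumℤ-++ : ∀ xs ys → sumℤ (xs ++ ys) ≡ sumℤ xs + sumℤ ys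
  sumℤ-++ []       ys = sym (ℤ.+-identityˡ (sumℤ ys))
  sumℤ-++ (x ∷ xs) ys = trans (cong (x +_) (sumℤ-++ xs ys)) (sym (ℤ.+-assoc x (sumℤ xs) (sumℤ ys)))

  sumℤ-*ˡ : ∀ {A : Set} a (f : A → ℤ) xs → sumℤ (map (λ x → a * f x) xs) ≡ a * sumℤ (map f xs)
  sumℤ-*ˡ a f []       = sym (ℤ.*-zeroʳ a)
  sumℤ-*ˡ a f (x ∷ xs) = trans (cong (a * f x +_) (sumℤ-*ˡ a f xs)) (sym (ℤ.*-distribˡ-+ a (f x) _))

  sumℤ-↭ : ∀ {xs ys} → xs ↭ ys → sumℤ xs ≡ sumℤ ys
  sumℤ-↭ p = foldr-commMonoid (setoid ℤ) ℤ.+-0-isCommutativeMonoid (↭⇒↭ₛ p)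

  sumℤ-map-bijection : ∀ {A B : Set} (g : A → ℤ) {as : List A} {bs : List B} (to : A → B) (from : B → A) →
    Unique as → Unique bs → (∀ b → b ∈ bs) → (∀ b → from b ∈ as) →
    (∀ {a} → a ∈ as → from (to a) ≡ a) → (∀ b → to (from b) ≡ b) →
    sumℤ (map g as) ≡ sumℤ (map (g ∘ from) bs)
  sumℤ-map-bijection g {as} {bs} to from as! bs! ∈bs from∈as from∘to to∘from =
    trans (sumℤ-↭ (Perm.map⁺ g as↭)) (cong sumℤ (sym (map-∘ bs)))
    where
    from-injective : ∀ {b b′} → from b ≡ from b′ → b ≡ b′
    from-injective {b} {b′} eq = trans (sym (to∘from b)) (trans (cong to eq) (to∘from b′))
    as↭ : as ↭ map from bs
    as↭ = ∼bag⇒↭ (unique∧set⇒bag as! (Unique.map⁺ from-injective bs!) (mk⇔ ⊆ ⊇))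
      where
      ⊆ : ∀ {a} → a ∈ as → a ∈ map from bs
      ⊆ {a} a∈ = subst (_∈ map from bs) (from∘to a∈) (∈-map⁺ from (∈bs (to a)))
      ⊇ : ∀ {a} → a ∈ map from bs → a ∈ as
      ⊇ a∈ with ∈-map⁻ from a∈
      ... | b , _ , refl = from∈as b


module QBinomial (q : ℤ) where

  open import Defs using (qbinom)
  open import Data.Nat as ℕ using (ℕ; zero; suc; _∸_; _≤_; _<_; s≤s)
  import Data.Nat.Properties as ℕ
  open import Data.Integer using (_+_; _-_; _*_; 1ℤ; 0ℤ; _^_)
  open import Data.Integer.Properties using (+-identityʳ; *-zeroˡ; *-zeroʳ; ^-distribˡ-+-*)
  open import Data.Integer.Tactic.RingSolver using (solve-∀)
  open import Data.Product using (_×_; _,_)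
  open import Relation.Nullary using (yes; no)
  open import Relation.Binary.PropositionalEquality
  open ≡-Reasoning
  open Sums using (∑<; ∑<-cong; ∑<-+; ∑<-*ˡ; ∑<-suc)

  infix 10 _C_
  _C_ : ℕ → ℕ → ℤ
  _C_ = qbinom q

  nC0≡1 : ∀ n → n C 0 ≡ 1ℤ
  nC0≡1 zero    = refl
  nC0≡1 (suc n) = refl

  k>n⇒nCk≡0 : ∀ {n k} → n < k → n C k ≡ 0ℤ
  k>n⇒nCk≡0 {zero}  {suc k} _         = refl
  k>n⇒nCk≡0 {suc n} {suc k} (s≤s n<k) = begin
    n C k + q ^ suc k * n C suc k   ≡⟨ cong₂ (λ a b → a + q ^ suc k * b) (k>n⇒nCk≡0 n<k) (k>n⇒nCk≡0 (ℕ.m<n⇒m<1+n n<k)) ⟩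
    0ℤ + q ^ suc k * 0ℤ             ≡⟨ cong (0ℤ +_) (*-zeroʳ (q ^ suc k)) ⟩
    0ℤ                              ∎

  qAbsorption : ∀ n k → (1ℤ - q ^ suc k) * n C suc k ≡ (1ℤ - q ^ (n ∸ k)) * n C k
  qAbsorption zero    zero    = *-zeroʳ (1ℤ - q ^ 1)
  qAbsorption zero    (suc k) = trans (*-zeroʳ (1ℤ - q ^ suc (suc k))) (sym (*-zeroʳ 0ℤ))
  qAbsorption (suc n) zero    = begin
    (1ℤ - q ^ 1) * (n C 0 + q ^ 1 * n C 1)       ≡⟨ cong (λ a → (1ℤ - q ^ 1) * (a + q ^ 1 * n C 1)) (nC0≡1 n) ⟩
    (1ℤ - q ^ 1) * (1ℤ + q ^ 1 * n C 1)          ≡⟨ expand q (n C 1) ⟩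
    1ℤ - q + q * ((1ℤ - q ^ 1) * n C 1)          ≡⟨ cong (λ a → 1ℤ - q + q * a) (trans (qAbsorption n 0) (cong ((1ℤ - q ^ n) *_) (nC0≡1 n))) ⟩
    1ℤ - q + q * ((1ℤ - q ^ n) * 1ℤ)             ≡⟨ collect q (q ^ n) ⟩
    (1ℤ - q * q ^ n) * 1ℤ                        ∎
    where
    expand : ∀ q x → (1ℤ - q * 1ℤ) * (1ℤ + q * 1ℤ * x) ≡ 1ℤ - q + q * ((1ℤ - q * 1ℤ) * x)
    expand = solve-∀
    collect : ∀ q y → 1ℤ - q + q * ((1ℤ - y) * 1ℤ) ≡ (1ℤ - q * y) * 1ℤ
    collect = solve-∀
  qAbsorption (suc n) (suc k) with n ℕ.≤? k
  ... | yes n≤k = begin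
    (1ℤ - q ^ suc (suc k)) * suc n C suc (suc k)   ≡⟨ cong ((1ℤ - q ^ suc (suc k)) *_) (k>n⇒nCk≡0 (s≤s (s≤s n≤k))) ⟩
    (1ℤ - q ^ suc (suc k)) * 0ℤ                    ≡⟨ *-zeroʳ (1ℤ - q ^ suc (suc k)) ⟩
    0ℤ                                             ≡⟨ sym (*-zeroˡ (suc n C suc k)) ⟩
    (1ℤ - q ^ 0) * suc n C suc k                   ≡⟨ cong (λ e → (1ℤ - q ^ e) * suc n C suc k) (sym (ℕ.m≤n⇒m∸n≡0 n≤k)) ⟩
    (1ℤ - q ^ (n ∸ k)) * suc n C suc k             ∎
  ... | no  n≰k = begin
    (1ℤ - q * Q) * (B + q * Q * n C suc (suc k))         ≡⟨ expand (q * Q) B (n C suc (suc k)) ⟩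
    (1ℤ - q * Q) * B + q * Q * ((1ℤ - q * Q) * n C suc (suc k))
                                                         ≡⟨ cong (λ x → (1ℤ - q * Q) * B + q * Q * x) (qAbsorption n (suc k)) ⟩
    (1ℤ - q * Q) * B + q * Q * ((1ℤ - q ^ E) * B)        ≡⟨ regroup q Q (q ^ E) B ⟩
    (1ℤ - Q) * B + (1ℤ - q * q ^ E) * (Q * B)            ≡⟨ cong₂ (λ x e → x + (1ℤ - q ^ e) * (Q * B)) (qAbsorption n k) (sym n∸k≡1+E) ⟩
    (1ℤ - q ^ (n ∸ k)) * A + (1ℤ - q ^ (n ∸ k)) * (Q * B) ≡⟨ factor (1ℤ - q ^ (n ∸ k)) A (Q * B) ⟩
    (1ℤ - q ^ (n ∸ k)) * (A + Q * B)                     ∎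
    where
    A = n C k
    B = n C suc k
    Q = q ^ suc k
    E = n ∸ suc k
    n∸k≡1+E : n ∸ k ≡ suc E
    n∸k≡1+E = ℕ.+-∸-assoc 1 (ℕ.≰⇒> n≰k)
    expand : ∀ P b c → (1ℤ - P) * (b + P * c) ≡ (1ℤ - P) * b + P * ((1ℤ - P) * c)
    expand = solve-∀
    regroup : ∀ q Q F b → (1ℤ - q * Q) * b + q * Q * ((1ℤ - F) * b) ≡ (1ℤ - Q) * b + (1ℤ - q * F) * (Q * b)
    regroup = solve-∀
    factor : ∀ a b c → a * b + a * c ≡ a * (b + c)
    factor = solve-∀

  qPascal′ : ∀ n k → suc n C suc k ≡ q ^ (n ∸ k) * n C k + n C suc k
  qPascal′ n k = begin
    A + Q * B                             ≡⟨ split A B Q E ⟩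
    (1ℤ - E) * A + (E * A + Q * B)        ≡⟨ cong (_+ (E * A + Q * B)) (sym (qAbsorption n k)) ⟩
    (1ℤ - Q) * B + (E * A + Q * B)        ≡⟨ cancel A B Q E ⟩
    E * A + B                             ∎
    where
    A = n C k
    B = n C suc k
    Q = q ^ suc k
    E = q ^ (n ∸ k)
    split : ∀ a b Q E → a + Q * b ≡ (1ℤ - E) * a + (E * a + Q * b)
    split = solve-∀
    cancel : ∀ a b Q E → (1ℤ - Q) * b + (E * a + Q * b) ≡ E * a + b
    cancel = solve-∀

  binomialSum ascendingSum descendingSum : ℕ → ℤ
  binomialSum   n = ∑< (suc n) (n C_)
  ascendingSum  n = ∑< (suc n) (λ h → q ^ h * n C h)
  descendingSum n = ∑< (suc n) (λ h → q ^ (n ∸ h) * n C h)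

  private
    q^[n∸h]*q^[1+h]≡q^[1+n] : ∀ {n h} → h ≤ n → q ^ (n ∸ h) * q ^ suc h ≡ q ^ suc n
    q^[n∸h]*q^[1+h]≡q^[1+n] {n} {h} h≤n = begin
      q ^ (n ∸ h) * q ^ suc h    ≡⟨ sym (^-distribˡ-+-* q (n ∸ h) (suc h)) ⟩
      q ^ (n ∸ h ℕ.+ suc h)      ≡⟨ cong (q ^_) (trans (ℕ.+-suc (n ∸ h) h) (cong suc (ℕ.m∸n+n≡m h≤n))) ⟩
      q ^ suc n                  ∎

    ∑<-upper : ∀ (w : ℕ → ℤ) n → ∑< (suc n) (λ h → w h * n C suc h) ≡ ∑< n (λ h → w h * n C suc h)
    ∑<-upper w n = begin
      ∑< (suc n) (λ h → w h * n C suc h)   ≡⟨ ∑<-suc (λ h → w h * n C suc h) n ⟩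
      lower + w n * n C suc n              ≡⟨ cong (λ x → lower + w n * x) (k>n⇒nCk≡0 (ℕ.n<1+n n)) ⟩
      lower + w n * 0ℤ                     ≡⟨ cong (lower +_) (*-zeroʳ (w n)) ⟩
      lower + 0ℤ                           ≡⟨ +-identityʳ lower ⟩
      lower                                ∎
      where
      lower = ∑< n (λ h → w h * n C suc h)

  descendingSum-suc : ∀ n → descendingSum (suc n) ≡ descendingSum n + q ^ suc n * binomialSum n
  descendingSum-suc n = begin
    q ^ suc n * suc n C 0 + ∑< (suc n) (λ h → q ^ (n ∸ h) * suc n C suc h)
      ≡⟨ cong₂ _+_ (cong (q ^ suc n *_) (nC0≡1 (suc n))) (∑<-cong (suc n) pascal) ⟩
    q ^ suc n * 1ℤ + ∑< (suc n) (λ h → q ^ (n ∸ h) * n C h + q ^ suc n * n C suc h)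
      ≡⟨ cong (q ^ suc n * 1ℤ +_) (∑<-+ (λ h → q ^ (n ∸ h) * n C h) (λ h → q ^ suc n * n C suc h) (suc n)) ⟩
    q ^ suc n * 1ℤ + (descendingSum n + ∑< (suc n) (λ h → q ^ suc n * n C suc h))
      ≡⟨ cong (λ x → q ^ suc n * 1ℤ + (descendingSum n + x)) (∑<-upper (λ _ → q ^ suc n) n) ⟩
    q ^ suc n * 1ℤ + (descendingSum n + ∑< n (λ h → q ^ suc n * n C suc h))
      ≡⟨ cong (λ x → q ^ suc n * 1ℤ + (descendingSum n + x)) (∑<-*ˡ (q ^ suc n) (λ h → n C suc h) n) ⟩
    q ^ suc n * 1ℤ + (descendingSum n + q ^ suc n * ∑< n (λ h → n C suc h))
      ≡⟨ regroup (q ^ suc n) (descendingSum n) (∑< n (λ h → n C suc h)) ⟩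
    descendingSum n + q ^ suc n * (1ℤ + ∑< n (λ h → n C suc h))
      ≡⟨ cong (λ x → descendingSum n + q ^ suc n * (x + ∑< n (λ h → n C suc h))) (sym (nC0≡1 n)) ⟩
    descendingSum n + q ^ suc n * binomialSum n
      ∎
    where
    pascal : ∀ h → h < suc n → q ^ (n ∸ h) * suc n C suc h ≡ q ^ (n ∸ h) * n C h + q ^ suc n * n C suc h
    pascal h (s≤s h≤n) = trans (distrib (q ^ (n ∸ h)) (n C h) (q ^ suc h) (n C suc h))
      (cong (λ x → q ^ (n ∸ h) * n C h + x * n C suc h) (q^[n∸h]*q^[1+h]≡q^[1+n] h≤n))
      where
      distrib : ∀ E a Q b → E * (a + Q * b) ≡ E * a + E * Q * b
      distrib = solve-∀
    regroup : ∀ P t x → P * 1ℤ + (t + P * x) ≡ t + P * (1ℤ + x)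
    regroup = solve-∀

  ascendingSum-suc : ∀ n → ascendingSum (suc n) ≡ ascendingSum n + q ^ suc n * binomialSum n
  ascendingSum-suc n = begin
    1ℤ * 1ℤ + ∑< (suc n) (λ h → q ^ suc h * suc n C suc h)
      ≡⟨ cong (1ℤ * 1ℤ +_) (∑<-cong (suc n) pascal) ⟩
    1ℤ * 1ℤ + ∑< (suc n) (λ h → q ^ suc n * n C h + q ^ suc h * n C suc h)
      ≡⟨ cong (1ℤ * 1ℤ +_) (∑<-+ (λ h → q ^ suc n * n C h) (λ h → q ^ suc h * n C suc h) (suc n)) ⟩
    1ℤ * 1ℤ + (∑< (suc n) (λ h → q ^ suc n * n C h) + ∑< (suc n) (λ h → q ^ suc h * n C suc h))
      ≡⟨ cong₂ (λ x y → 1ℤ * 1ℤ + (x + y)) (∑<-*ˡ (q ^ suc n) (n C_) (suc n)) (∑<-upper (λ h → q ^ suc h) n) ⟩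
    1ℤ * 1ℤ + (q ^ suc n * binomialSum n + ∑< n (λ h → q ^ suc h * n C suc h))
      ≡⟨ regroup (q ^ suc n * binomialSum n) (∑< n (λ h → q ^ suc h * n C suc h)) ⟩
    1ℤ * 1ℤ + ∑< n (λ h → q ^ suc h * n C suc h) + q ^ suc n * binomialSum n
      ≡⟨ cong (λ x → 1ℤ * x + ∑< n (λ h → q ^ suc h * n C suc h) + q ^ suc n * binomialSum n) (sym (nC0≡1 n)) ⟩
    ascendingSum n + q ^ suc n * binomialSum n
      ∎
    where
    pascal : ∀ h → h < suc n → q ^ suc h * suc n C suc h ≡ q ^ suc n * n C h + q ^ suc h * n C suc h
    pascal h (s≤s h≤n) = begin
      q ^ suc h * suc n C suc h                              ≡⟨ cong (q ^ suc h *_) (qPascal′ n h) ⟩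
      q ^ suc h * (q ^ (n ∸ h) * n C h + n C suc h)          ≡⟨ distrib (q ^ suc h) (q ^ (n ∸ h)) (n C h) (n C suc h) ⟩
      q ^ (n ∸ h) * q ^ suc h * n C h + q ^ suc h * n C suc h ≡⟨ cong (λ x → x * n C h + q ^ suc h * n C suc h) (q^[n∸h]*q^[1+h]≡q^[1+n] h≤n) ⟩
      q ^ suc n * n C h + q ^ suc h * n C suc h               ∎
      where
      distrib : ∀ Q E a b → Q * (E * a + b) ≡ E * Q * a + Q * b
      distrib = solve-∀
    regroup : ∀ a y → 1ℤ * 1ℤ + (a + y) ≡ 1ℤ * 1ℤ + y + a
    regroup = solve-∀

  binomialSum-suc : ∀ n → binomialSum (suc n) ≡ binomialSum n + ascendingSum n
  binomialSum-suc n = begin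
    1ℤ + ∑< (suc n) (λ h → n C h + q ^ suc h * n C suc h)
      ≡⟨ cong (1ℤ +_) (∑<-+ (n C_) (λ h → q ^ suc h * n C suc h) (suc n)) ⟩
    1ℤ + (binomialSum n + ∑< (suc n) (λ h → q ^ suc h * n C suc h))
      ≡⟨ cong (λ x → 1ℤ + (binomialSum n + x)) (∑<-upper (λ h → q ^ suc h) n) ⟩
    1ℤ + (binomialSum n + ∑< n (λ h → q ^ suc h * n C suc h))
      ≡⟨ regroup (binomialSum n) (∑< n (λ h → q ^ suc h * n C suc h)) ⟩
    binomialSum n + (1ℤ * 1ℤ + ∑< n (λ h → q ^ suc h * n C suc h))
      ≡⟨ cong (λ x → binomialSum n + (1ℤ * x + ∑< n (λ h → q ^ suc h * n C suc h))) (sym (nC0≡1 n)) ⟩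
    binomialSum n + ascendingSum n
      ∎
    where
    regroup : ∀ s y → 1ℤ + (s + y) ≡ s + (1ℤ * 1ℤ + y)
    regroup = solve-∀

  ascendingSum≡descendingSum : ∀ n → ascendingSum n ≡ descendingSum n
  ascendingSum≡descendingSum zero    = refl
  ascendingSum≡descendingSum (suc n) = begin
    ascendingSum (suc n)                           ≡⟨ ascendingSum-suc n ⟩
    ascendingSum n + q ^ suc n * binomialSum n     ≡⟨ cong (_+ q ^ suc n * binomialSum n) (ascendingSum≡descendingSum n) ⟩
    descendingSum n + q ^ suc n * binomialSum n    ≡⟨ sym (descendingSum-suc n) ⟩
    descendingSum (suc n)                          ∎

  binomialSum-suc′ : ∀ n → binomialSum (suc n) ≡ binomialSum n + descendingSum n
  binomialSum-suc′ n = trans (binomialSum-suc n) (cong (binomialSum n +_) (ascendingSum≡descendingSum n))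

  descendingSum-unique : (W Z : ℕ → ℤ) → W 0 ≡ 1ℤ → Z 0 ≡ 1ℤ →
    (∀ n → W (suc n) ≡ W n + q ^ suc n * Z n) → (∀ n → Z (suc n) ≡ Z n + W n) →
    ∀ n → W n ≡ descendingSum n × Z n ≡ binomialSum n
  descendingSum-unique W Z W0 Z0 W-suc Z-suc zero = W0 , Z0
  descendingSum-unique W Z W0 Z0 W-suc Z-suc (suc n)
    with W≡ , Z≡ ← descendingSum-unique W Z W0 Z0 W-suc Z-suc n =
    trans (W-suc n) (trans (cong₂ (λ w z → w + q ^ suc n * z) W≡ Z≡) (sym (descendingSum-suc n))) ,
    trans (Z-suc n) (trans (cong₂ _+_ Z≡ W≡) (sym (binomialSum-suc′ n)))

  binomialSum-identity : ∀ n → binomialSum n + (q ^ n - 1ℤ) * binomialSum (n ∸ 1) ≡ descendingSum n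
  binomialSum-identity zero    = refl
  binomialSum-identity (suc n) = begin
    binomialSum (suc n) + (q ^ suc n - 1ℤ) * binomialSum n       ≡⟨ cong (_+ (q ^ suc n - 1ℤ) * binomialSum n) (binomialSum-suc′ n) ⟩
    binomialSum n + descendingSum n + (q ^ suc n - 1ℤ) * binomialSum n
                                                                 ≡⟨ cancel (binomialSum n) (descendingSum n) (q ^ suc n) ⟩
    descendingSum n + q ^ suc n * binomialSum n                  ≡⟨ sym (descendingSum-suc n) ⟩
    descendingSum (suc n)                                        ∎
    where
    cancel : ∀ s t P → s + t + (P - 1ℤ) * s ≡ t + P * s
    cancel = solve-∀


module Words where

  open import Defs using (range1)
  open Sums using (sumℤ; sumℤ-++; sumℤ-*ˡ)
  open import Data.Nat as ℕ using (ℕ; zero; suc; _+_; _∸_; _≤_; _<_; s≤s)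
  import Data.Nat.Properties as ℕ
  open import Data.Nat.ListAction using (sum)
  open import Data.Nat.ListAction.Properties using (sum-++)
  open import Data.Bool using (Bool; true; false; _∧_; not; if_then_else_)
  open import Data.Bool.Properties using (∧-identityʳ; ∧-zeroʳ)
  open import Data.Vec using (Vec; []; _∷_)
  open import Data.Vec.Properties using (∷-injectiveʳ)
  open import Data.List using (List; []; _∷_; [_]; map; filter; upTo; _++_; _∷ʳ_)
  open import Data.List.Properties using (map-++; filter-++; map-∘; map-cong; applyUpTo-∷ʳ)
  open import Data.List.Membership.Propositional using (_∈_)
  open import Data.List.Membership.Propositional.Properties using (∈-map⁺; ∈-map⁻; ∈-++⁺ˡ; ∈-++⁺ʳ)
  open import Data.List.Relation.Unary.Any using (here)
  open import Data.List.Relation.Unary.All using ([])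
  open import Data.List.Relation.Unary.AllPairs using ([]; _∷_)
  open import Data.List.Relation.Unary.Unique.Propositional using (Unique)
  import Data.List.Relation.Unary.Unique.Propositional.Properties as Unique
  open import Data.Integer using (ℤ) renaming (_+_ to _+ℤ_; _*_ to _*ℤ_; _^_ to _^ℤ_)
  import Data.Integer.Properties as ℤ
  open import Data.Product using (_×_; _,_; proj₁)
  open import Data.Empty using (⊥; ⊥-elim)
  open import Data.Sum using (inj₁; inj₂)
  open import Function using (_∘_; _⇔_; Equivalence)
  open import Relation.Nullary using (does; yes; no)
  open import Relation.Nullary.Decidable using (dec-true; dec-false)
  open import Relation.Unary using (Decidable)
  open import Relation.Binary.PropositionalEquality hiding ([_])
  open ≡-Reasoning

  -- Bit i of a word c : Vec Bool n; the head of c is bit n − 1, and bits i ≥ n are false.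
  bit : ∀ {n} → Vec Bool n → ℕ → Bool
  bit         []      i = false
  bit {suc n} (x ∷ c) i = if does (i ℕ.≟ n) then x else bit c i

  bit-head : ∀ {n} x (c : Vec Bool n) → bit (x ∷ c) n ≡ x
  bit-head {n} x c rewrite dec-true (n ℕ.≟ n) refl = refl

  bit-tail : ∀ {n} x (c : Vec Bool n) {i} → i < n → bit (x ∷ c) i ≡ bit c i
  bit-tail {n} x c {i} i<n rewrite dec-false (i ℕ.≟ n) (ℕ.<⇒≢ i<n) = refl

  bit-out : ∀ {n} (c : Vec Bool n) {i} → n ≤ i → bit c i ≡ false
  bit-out {zero}  []      _   = refl
  bit-out {suc n} (x ∷ c) {i} n<i
    rewrite dec-false (i ℕ.≟ n) (ℕ.>⇒≢ n<i) = bit-out c (ℕ.<⇒≤ n<i)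

  fromBits : (ℕ → Bool) → (k : ℕ) → Vec Bool k
  fromBits p zero    = []
  fromBits p (suc k) = p k ∷ fromBits p k

  bit-fromBits : ∀ p k {i} → i < k → bit (fromBits p k) i ≡ p i
  bit-fromBits p (suc k) {i} i<1+k with ℕ.m≤n⇒m<n∨m≡n (ℕ.≤-pred i<1+k)
  ... | inj₁ i<k  = trans (bit-tail (p k) (fromBits p k) i<k) (bit-fromBits p k i<k)
  ... | inj₂ refl = bit-head (p i) (fromBits p i)

  fromBits-bit : ∀ {k} p (c : Vec Bool k) → (∀ i → i < k → p i ≡ bit c i) → fromBits p k ≡ c
  fromBits-bit p []              p≡c = refl
  fromBits-bit {suc k} p (x ∷ c) p≡c = cong₂ _∷_
    (trans (p≡c k (ℕ.n<1+n k)) (bit-head x c))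
    (fromBits-bit p c (λ i i<k → trans (p≡c i (ℕ.m<n⇒m<1+n i<k)) (bit-tail x c i<k)))

  allWords : (n : ℕ) → List (Vec Bool n)
  allWords zero    = [ [] ]
  allWords (suc n) = map (false ∷_) (allWords n) ++ map (true ∷_) (allWords n)

  ∈-allWords : ∀ {n} (c : Vec Bool n) → c ∈ allWords n
  ∈-allWords []          = here refl
  ∈-allWords (false ∷ c) = ∈-++⁺ˡ (∈-map⁺ (false ∷_) (∈-allWords c))
  ∈-allWords {suc n} (true ∷ c) = ∈-++⁺ʳ (map (false ∷_) (allWords n)) (∈-map⁺ (true ∷_) (∈-allWords c))

  allWords-unique : ∀ n → Unique (allWords n)
  allWords-unique zero    = [] ∷ []
  allWords-unique (suc n) = Unique.++⁺ (Unique.map⁺ ∷-injectiveʳ (allWords-unique n))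
                                       (Unique.map⁺ ∷-injectiveʳ (allWords-unique n)) disjoint
    where
    disjoint : ∀ {v} → v ∈ map (false ∷_) (allWords n) × v ∈ map (true ∷_) (allWords n) → ⊥
    disjoint (v∈₀ , v∈₁) with ∈-map⁻ (false ∷_) v∈₀ | ∈-map⁻ (true ∷_) v∈₁
    ... | _ , _ , refl | _ , _ , ()

  indexSum : (ℕ → Bool) → ℕ → ℕ
  indexSum g zero    = 0
  indexSum g (suc k) = indexSum g k + (if g k then suc k else 0)

  indexSum-cong : ∀ {g g′} K → (∀ k → k < K → g k ≡ g′ k) → indexSum g K ≡ indexSum g′ K
  indexSum-cong zero    g≡g′ = refl
  indexSum-cong (suc K) g≡g′ = cong₂ _+_ (indexSum-cong K (λ k k<K → g≡g′ k (ℕ.m<n⇒m<1+n k<K)))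
                                         (cong (λ b → if b then suc K else 0) (g≡g′ K ℕ.≤-refl))

  sum-filter-range1 : ∀ {P : ℕ → Set} (P? : Decidable P) (g : ℕ → Bool) K →
    (∀ k → k < K → P (suc k) ⇔ g k ≡ true) → sum (filter P? (range1 K)) ≡ indexSum g K
  sum-filter-range1 P? g zero    P⇔g = refl
  sum-filter-range1 P? g (suc K) P⇔g = begin
    sum (filter P? (map suc (upTo (suc K))))
      ≡⟨ cong (λ l → sum (filter P? (map suc l))) (sym (applyUpTo-∷ʳ Function.id K)) ⟩
    sum (filter P? (map suc (upTo K ∷ʳ K)))
      ≡⟨ cong (sum ∘ filter P?) (map-++ suc (upTo K) [ K ]) ⟩
    sum (filter P? (range1 K ++ [ suc K ]))
      ≡⟨ cong sum (filter-++ P? (range1 K) [ suc K ]) ⟩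
    sum (filter P? (range1 K) ++ filter P? [ suc K ])
      ≡⟨ sum-++ (filter P? (range1 K)) (filter P? [ suc K ]) ⟩
    sum (filter P? (range1 K)) + sum (filter P? [ suc K ])
      ≡⟨ cong₂ _+_ (sum-filter-range1 P? g K (λ k k<K → P⇔g k (ℕ.m<n⇒m<1+n k<K))) last ⟩
    indexSum g (suc K)
      ∎
    where
    last : sum (filter P? [ suc K ]) ≡ (if g K then suc K else 0)
    last with P? (suc K) | g K in gK
    ... | yes _  | true  = ℕ.+-identityʳ (suc K)
    ... | yes p  | false with () ← trans (sym gK) (Equivalence.to (P⇔g K ℕ.≤-refl) p)
    ... | no ¬p  | true  = ⊥-elim (¬p (Equivalence.from (P⇔g K ℕ.≤-refl) gK))
    ... | no _   | false = refl

  descentSum : (ℕ → Bool) → ℕ → ℕ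
  descentSum β = indexSum (λ k → β k ∧ not (β (suc k)))

  -- As bit n is false, a final 1 of c contributes the descent at n; innerMaj omits it.
  majWord : ∀ {n} → Vec Bool n → ℕ
  majWord {n} c = descentSum (bit c) n

  innerMaj : ∀ {n} → Vec Bool n → ℕ
  innerMaj {n} c = descentSum (bit c) (n ∸ 1)

  lastBit : ∀ {n} → Vec Bool n → Bool
  lastBit {n} c = bit c (n ∸ 1)

  majWord-split : ∀ {n} (c : Vec Bool n) → majWord c ≡ innerMaj c + (if lastBit c then n else 0)
  majWord-split {zero}  []                                      = refl
  majWord-split {suc n} c rewrite bit-out c (ℕ.≤-refl {suc n}) with bit c n
  ... | true  = refl
  ... | false = refl

  innerMaj-∷ : ∀ {n} x (c : Vec Bool n) → innerMaj (x ∷ c) ≡ innerMaj c + (if lastBit c ∧ not x then n else 0)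
  innerMaj-∷ {zero}  x [] = refl
  innerMaj-∷ {suc n} x c  = cong₂ _+_
    (indexSum-cong n (λ k k<n → cong₂ (λ a b → a ∧ not b) (bit-tail x c (ℕ.m<n⇒m<1+n k<n)) (bit-tail x c (s≤s k<n))))
    (cong (λ b → if b then suc n else 0) (cong₂ (λ a b → a ∧ not b) (bit-tail x c (ℕ.n<1+n n)) (bit-head x c)))

  majWord-false∷ : ∀ {n} (c : Vec Bool n) → majWord (false ∷ c) ≡ majWord c
  majWord-false∷ {n} c = begin
    majWord (false ∷ c)                                         ≡⟨ majWord-split (false ∷ c) ⟩
    innerMaj (false ∷ c) + (if lastBit (false ∷ c) then suc n else 0)
                                                                ≡⟨ cong₂ (λ i b → i + (if b then suc n else 0)) (innerMaj-∷ false c) (bit-head false c) ⟩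
    innerMaj c + (if lastBit c ∧ true then n else 0) + 0        ≡⟨ ℕ.+-identityʳ _ ⟩
    innerMaj c + (if lastBit c ∧ true then n else 0)            ≡⟨ cong (λ b → innerMaj c + (if b then n else 0)) (∧-identityʳ (lastBit c)) ⟩
    innerMaj c + (if lastBit c then n else 0)                   ≡⟨ majWord-split c ⟨
    majWord c                                                   ∎

  majWord-true∷ : ∀ {n} (c : Vec Bool n) → majWord (true ∷ c) ≡ suc n + innerMaj c
  majWord-true∷ {n} c = begin
    majWord (true ∷ c)                                          ≡⟨ majWord-split (true ∷ c) ⟩
    innerMaj (true ∷ c) + (if lastBit (true ∷ c) then suc n else 0)
                                                                ≡⟨ cong₂ (λ i b → i + (if b then suc n else 0)) (innerMaj-∷ true c) (bit-head true c) ⟩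
    innerMaj c + (if lastBit c ∧ false then n else 0) + suc n   ≡⟨ cong (λ b → innerMaj c + (if b then n else 0) + suc n) (∧-zeroʳ (lastBit c)) ⟩
    innerMaj c + 0 + suc n                                      ≡⟨ cong (_+ suc n) (ℕ.+-identityʳ (innerMaj c)) ⟩
    innerMaj c + suc n                                          ≡⟨ ℕ.+-comm (innerMaj c) (suc n) ⟩
    suc n + innerMaj c                                          ∎

  innerMaj-false∷ : ∀ {n} (c : Vec Bool n) → innerMaj (false ∷ c) ≡ majWord c
  innerMaj-false∷ {n} c = begin
    innerMaj (false ∷ c)                                ≡⟨ innerMaj-∷ false c ⟩
    innerMaj c + (if lastBit c ∧ true then n else 0)    ≡⟨ cong (λ b → innerMaj c + (if b then n else 0)) (∧-identityʳ (lastBit c)) ⟩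
    innerMaj c + (if lastBit c then n else 0)           ≡⟨ majWord-split c ⟨
    majWord c                                           ∎

  innerMaj-true∷ : ∀ {n} (c : Vec Bool n) → innerMaj (true ∷ c) ≡ innerMaj c
  innerMaj-true∷ {n} c = begin
    innerMaj (true ∷ c)                                 ≡⟨ innerMaj-∷ true c ⟩
    innerMaj c + (if lastBit c ∧ false then n else 0)   ≡⟨ cong (λ b → innerMaj c + (if b then n else 0)) (∧-zeroʳ (lastBit c)) ⟩
    innerMaj c + 0                                      ≡⟨ ℕ.+-identityʳ (innerMaj c) ⟩
    innerMaj c                                          ∎

  module GeneratingFunction (q : ℤ) where

    open QBinomial q using (descendingSum; descendingSum-unique)

    wordSum : ∀ n → (Vec Bool n → ℕ) → ℤ
    wordSum n s = sumℤ (map (λ c → q ^ℤ s c) (allWords n))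

    wordSum-cong : ∀ n {s s′ : Vec Bool n → ℕ} → (∀ c → s c ≡ s′ c) → wordSum n s ≡ wordSum n s′
    wordSum-cong n s≡s′ = cong sumℤ (map-cong (λ c → cong (q ^ℤ_) (s≡s′ c)) (allWords n))

    wordSum-suc : ∀ n (s : Vec Bool (suc n) → ℕ) →
      wordSum (suc n) s ≡ wordSum n (s ∘ (false ∷_)) +ℤ wordSum n (s ∘ (true ∷_))
    wordSum-suc n s = begin
      sumℤ (map f (map (false ∷_) (allWords n) ++ map (true ∷_) (allWords n)))
        ≡⟨ cong sumℤ (map-++ f (map (false ∷_) (allWords n)) (map (true ∷_) (allWords n))) ⟩
      sumℤ (map f (map (false ∷_) (allWords n)) ++ map f (map (true ∷_) (allWords n)))
        ≡⟨ sumℤ-++ (map f (map (false ∷_) (allWords n))) (map f (map (true ∷_) (allWords n))) ⟩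
      sumℤ (map f (map (false ∷_) (allWords n))) +ℤ sumℤ (map f (map (true ∷_) (allWords n)))
        ≡⟨ cong₂ (λ x y → sumℤ x +ℤ sumℤ y) (map-∘ (allWords n)) (map-∘ (allWords n)) ⟨
      wordSum n (s ∘ (false ∷_)) +ℤ wordSum n (s ∘ (true ∷_))
        ∎
      where
      f = λ c → q ^ℤ s c

    majWord-suc : ∀ n → wordSum (suc n) majWord ≡ wordSum n majWord +ℤ q ^ℤ suc n *ℤ wordSum n innerMaj
    majWord-suc n = begin
      wordSum (suc n) majWord
        ≡⟨ wordSum-suc n majWord ⟩
      wordSum n (majWord ∘ (false ∷_)) +ℤ wordSum n (majWord ∘ (true ∷_))
        ≡⟨ cong₂ _+ℤ_ (wordSum-cong n majWord-false∷) (wordSum-cong n majWord-true∷) ⟩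
      wordSum n majWord +ℤ wordSum n (λ c → suc n + innerMaj c)
        ≡⟨ cong (wordSum n majWord +ℤ_) (cong sumℤ (map-cong (λ c → ℤ.^-distribˡ-+-* q (suc n) (innerMaj c)) (allWords n))) ⟩
      wordSum n majWord +ℤ sumℤ (map (λ c → q ^ℤ suc n *ℤ q ^ℤ innerMaj c) (allWords n))
        ≡⟨ cong (wordSum n majWord +ℤ_) (sumℤ-*ˡ (q ^ℤ suc n) (λ c → q ^ℤ innerMaj c) (allWords n)) ⟩
      wordSum n majWord +ℤ q ^ℤ suc n *ℤ wordSum n innerMaj
        ∎

    innerMaj-suc : ∀ n → wordSum (suc n) innerMaj ≡ wordSum n innerMaj +ℤ wordSum n majWord
    innerMaj-suc n = begin
      wordSum (suc n) innerMaj
        ≡⟨ wordSum-suc n innerMaj ⟩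
      wordSum n (innerMaj ∘ (false ∷_)) +ℤ wordSum n (innerMaj ∘ (true ∷_))
        ≡⟨ cong₂ _+ℤ_ (wordSum-cong n innerMaj-false∷) (wordSum-cong n innerMaj-true∷) ⟩
      wordSum n majWord +ℤ wordSum n innerMaj
        ≡⟨ ℤ.+-comm (wordSum n majWord) (wordSum n innerMaj) ⟩
      wordSum n innerMaj +ℤ wordSum n majWord
        ∎

    wordSum-majWord : ∀ n → wordSum n majWord ≡ descendingSum n
    wordSum-majWord n = proj₁ (descendingSum-unique (λ n → wordSum n majWord) (λ n → wordSum n innerMaj)
                                                    refl refl majWord-suc innerMaj-suc n)


module Enumeration where

  open import Defs using (allVecs)
  open import Data.Nat using (zero; suc)
  open import Data.Fin using (Fin)
  open import Data.Vec using (Vec; []; _∷_)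
  open import Data.Vec.Properties using (∷-injectiveˡ; ∷-injectiveʳ)
  open import Data.List using (List; []; _∷_; map; concatMap)
  open import Data.List.Membership.Propositional using (_∈_)
  open import Data.List.Membership.Propositional.Properties using (∈-map⁺; ∈-map⁻; ∈-concat⁺′; ∈-concat⁻′; ∈-allFin)
  open import Data.List.Relation.Unary.All using (All; []; _∷_)
  open import Data.List.Relation.Unary.AllPairs using ([]; _∷_)
  open import Data.List.Relation.Unary.Any using (here; there)
  open import Data.List.Relation.Unary.Unique.Propositional using (Unique)
  import Data.List.Relation.Unary.Unique.Propositional.Properties as Unique
  open import Data.Empty using (⊥)
  open import Data.Product using (_×_; _,_)
  open import Relation.Binary.PropositionalEquality

  concatMap-unique : ∀ {A B : Set} (f : A → List B) {xs : List A} → Unique xs → (∀ x → Unique (f x)) →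
    (∀ {y x x′} → y ∈ f x → y ∈ f x′ → x ≡ x′) → Unique (concatMap f xs)
  concatMap-unique f {[]}     []           f! disjoint = []
  concatMap-unique f {x ∷ xs} (x∉xs ∷ xs!) f! disjoint =
    Unique.++⁺ (f! x) (concatMap-unique f xs! f! disjoint) separate
    where
    separate : ∀ {y} → y ∈ f x × y ∈ concatMap f xs → ⊥
    separate (y∈fx , y∈rest) with ∈-concat⁻′ (map f xs) y∈rest
    ... | ys , y∈ys , ys∈ with ∈-map⁻ f ys∈
    ... | x′ , x′∈xs , refl = distinct x∉xs x′∈xs (disjoint y∈fx y∈ys)
      where
      distinct : ∀ {z zs} → All (x ≢_) zs → z ∈ zs → x ≡ z → ⊥
      distinct (x≢z ∷ _)   (here refl) = x≢z
      distinct (_   ∷ x≢s) (there z∈)  = distinct x≢s z∈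

  ∈-allVecs : ∀ {k m} (v : Vec (Fin m) k) → v ∈ allVecs k m
  ∈-allVecs         []      = here refl
  ∈-allVecs {m = m} (i ∷ v) =
    ∈-concat⁺′ (∈-map⁺ (i ∷_) (∈-allVecs v)) (∈-map⁺ (λ j → map (j ∷_) (allVecs _ m)) (∈-allFin i))

  allVecs-unique : ∀ k m → Unique (allVecs k m)
  allVecs-unique zero    m = [] ∷ []
  allVecs-unique (suc k) m = concatMap-unique _ (Unique.allFin⁺ m)
    (λ i → Unique.map⁺ ∷-injectiveʳ (allVecs-unique k m)) sameHead
    where
    sameHead : ∀ {y i j} → y ∈ map (i ∷_) (allVecs k m) → y ∈ map (j ∷_) (allVecs k m) → i ≡ j
    sameHead y∈ y∈′ with ∈-map⁻ _ y∈ | ∈-map⁻ _ y∈′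
    ... | _ , _ , refl | _ , _ , eq = ∷-injectiveˡ eq


module Involutions where

  open import Defs
  open import Data.Nat as ℕ using (ℕ; suc; s≤s)
  import Data.Nat.Properties as ℕ
  open import Data.Fin using (Fin; toℕ; opposite; _<_)
  open import Data.Fin.Properties using (<-cmp; <-irrefl; <-asym; opposite-prop; opposite-involutive; toℕ<n)
  open import Data.Vec using (lookup)
  open import Data.Vec.Properties using (tabulate∘lookup; tabulate-cong)
  open import Data.Product using (_,_; proj₁; proj₂)
  open import Data.Empty using (⊥-elim)
  open import Data.Sum using (_⊎_; inj₁; inj₂)
  open import Function using (_∘_; _⇔_; mk⇔; Equivalence)
  import Function.Properties.Equivalence as ⇔
  open import Relation.Nullary using (¬_)
  open import Relation.Binary.Definitions using (tri<; tri≈; tri>)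
  open import Relation.Binary.PropositionalEquality

  open Equivalence using (to; from)

  module _ {m : ℕ} where

    record Involution321 (π : Map m) : Set where
      field
        injective  : IsPerm π
        involutive : IsInvolution π
        avoids321  : Avoids321 π

    open Involution321

    Opener : Map m → Fin m → Set
    Opener π i = i < lookup π i

    SameOpenersBelow : ℕ → Map m → Map m → Set
    SameOpenersBelow x π σ = ∀ c → toℕ c ℕ.< x → Opener π c ⇔ Opener σ c

    AgreeOnClosersBelow : ℕ → Map m → Map m → Set
    AgreeOnClosersBelow x π σ = ∀ c → toℕ c ℕ.< x → ¬ Opener π c → lookup π c ≡ lookup σ c

    openers-increasing : ∀ {π} → Involution321 π → ∀ {i j} → i < j → Opener π i → Opener π j →
                         lookup π i < lookup π j
    openers-increasing {π} π321 {i} {j} i<j _ j<πj with <-cmp (lookup π i) (lookup π j)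
    ... | tri< πi<πj _ _ = πi<πj
    ... | tri≈ _ πi≡πj _ = ⊥-elim (<-irrefl (injective π321 i j πi≡πj) i<j)
    ... | tri> _ _ πj<πi = ⊥-elim (avoids321 π321 i j (lookup π j)
            (i<j , j<πj , πj<πi , subst (_< lookup π j) (sym (involutive π321 j)) j<πj))

    -- If y is a closer of π whose partner o opens in σ too, then the σ-partner c of o is y
    -- as soon as c < y: c then closes in both, so π c = σ c = o by the agreement below y.
    module _ {π σ} (π321 : Involution321 π) (σ321 : Involution321 σ) {y : Fin m}
             (same : SameOpenersBelow (toℕ y) π σ) (agree : AgreeOnClosersBelow (toℕ y) π σ)
             (πy<y : lookup π y < y) where
      private
        o = lookup π y
        c = lookup σ o

        σ-opener-o : Opener σ o
        σ-opener-o = to (same o πy<y) (subst (o <_) (sym (involutive π321 y)) πy<y)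

        ¬π-opener-c : c < y → ¬ Opener π c
        ¬π-opener-c c<y c<πc = <-asym σ-opener-o (subst (c <_) (involutive σ321 o) (to (same c c<y) c<πc))

        c<y⇒c≡y : c < y → c ≡ y
        c<y⇒c≡y c<y = begin
          c                      ≡⟨ involutive π321 c ⟨
          lookup π (lookup π c)  ≡⟨ cong (lookup π) (trans (agree c c<y (¬π-opener-c c<y)) (involutive σ321 o)) ⟩
          lookup π o             ≡⟨ involutive π321 y ⟩
          y                      ∎
          where open ≡-Reasoning

      closer-not-fixed : lookup σ y ≢ y
      closer-not-fixed σy≡y with <-cmp c y
      ... | tri< c<y _ _ = <-irrefl (c<y⇒c≡y c<y) c<y
      ... | tri≈ _ c≡y _ = <-irrefl (injective σ321 o y (trans c≡y (sym σy≡y))) πy<y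
      ... | tri> _ _ y<c = avoids321 σ321 o y c (πy<y , y<c , subst (_< c) (sym σy≡y) y<c ,
                                                subst₂ _<_ (sym (involutive σ321 o)) (sym σy≡y) πy<y)

      closer-partners-ordered : lookup σ y < y → ¬ (lookup π y < lookup σ y)
      closer-partners-ordered σy<y o<σy = <-irrefl (c<y⇒c≡y c<y) c<y
        where
        σ-opener-σy : Opener σ (lookup σ y)
        σ-opener-σy = subst (lookup σ y <_) (sym (involutive σ321 y)) σy<y
        c<y : c < y
        c<y = subst (c <_) (involutive σ321 y) (openers-increasing σ321 o<σy σ-opener-o σ-opener-σy)

    SameOpenersBelow-sym : ∀ {x π σ} → SameOpenersBelow x π σ → SameOpenersBelow x σ π
    SameOpenersBelow-sym same c c<x = ⇔.sym (same c c<x)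

    AgreeOnClosersBelow-sym : ∀ {x π σ} → SameOpenersBelow x π σ → AgreeOnClosersBelow x π σ →
                              AgreeOnClosersBelow x σ π
    AgreeOnClosersBelow-sym same agree c c<x ¬σ-opener = sym (agree c c<x (¬σ-opener ∘ to (same c c<x)))

    closer-agrees : ∀ {π σ} → Involution321 π → Involution321 σ → ∀ {y} →
      SameOpenersBelow (toℕ y) π σ → AgreeOnClosersBelow (toℕ y) π σ →
      ¬ Opener π y → ¬ Opener σ y → lookup π y ≡ lookup σ y
    closer-agrees {π} {σ} π321 σ321 {y} same agree ¬π-opener ¬σ-opener
      with <-cmp (lookup π y) y | <-cmp (lookup σ y) y
    ... | tri> _ _ y<πy | _              = ⊥-elim (¬π-opener y<πy)
    ... | _              | tri> _ _ y<σy = ⊥-elim (¬σ-opener y<σy)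
    ... | tri≈ _ πy≡y _  | tri≈ _ σy≡y _ = trans πy≡y (sym σy≡y)
    ... | tri< πy<y _ _  | tri≈ _ σy≡y _ = ⊥-elim (closer-not-fixed π321 σ321 same agree πy<y σy≡y)
    ... | tri≈ _ πy≡y _  | tri< σy<y _ _ =
      ⊥-elim (closer-not-fixed σ321 π321 (SameOpenersBelow-sym {π = π} {σ} same) (AgreeOnClosersBelow-sym {π = π} {σ} same agree) σy<y πy≡y)
    ... | tri< πy<y _ _  | tri< σy<y _ _ with <-cmp (lookup π y) (lookup σ y)
    ...   | tri≈ _ πy≡σy _ = πy≡σy
    ...   | tri< πy<σy _ _ = ⊥-elim (closer-partners-ordered π321 σ321 same agree πy<y σy<y πy<σy)
    ...   | tri> _ _ σy<πy = ⊥-elim (closer-partners-ordered σ321 π321 (SameOpenersBelow-sym {π = π} {σ} same)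
                                       (AgreeOnClosersBelow-sym {π = π} {σ} same agree) σy<y πy<y σy<πy)

    SameOpenersBelow-suc⁻ : ∀ {x π σ} → SameOpenersBelow (suc x) π σ → SameOpenersBelow x π σ
    SameOpenersBelow-suc⁻ same c c<x = same c (ℕ.m<n⇒m<1+n c<x)

    closers-agree : ∀ {π σ} → Involution321 π → Involution321 σ → ∀ x →
                    SameOpenersBelow x π σ → AgreeOnClosersBelow x π σ
    closers-agree {π} {σ} π321 σ321 (suc x) same c c<1+x ¬π-opener with ℕ.m≤n⇒m<n∨m≡n (ℕ.≤-pred c<1+x)
    ... | inj₁ c<x  = closers-agree π321 σ321 x (SameOpenersBelow-suc⁻ {π = π} {σ} same) c c<x ¬π-opener
    ... | inj₂ refl = closer-agrees π321 σ321 (SameOpenersBelow-suc⁻ {π = π} {σ} same)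
                        (closers-agree π321 σ321 x (SameOpenersBelow-suc⁻ {π = π} {σ} same)) ¬π-opener (¬π-opener ∘ from (same c c<1+x))

    same-openers⇒≡ : ∀ {π σ} → Involution321 π → Involution321 σ → SameOpenersBelow m π σ → π ≡ σ
    same-openers⇒≡ {π} {σ} π321 σ321 same =
      trans (sym (tabulate∘lookup π)) (trans (tabulate-cong πy≡σy) (tabulate∘lookup σ))
      where
      agree = closers-agree π321 σ321 m same
      πy≡σy : ∀ y → lookup π y ≡ lookup σ y
      πy≡σy y with <-cmp y (lookup π y)
      ... | tri< y<πy _ _ = begin
        lookup π y                       ≡⟨ involutive σ321 (lookup π y) ⟨
        lookup σ (lookup σ (lookup π y)) ≡⟨ cong (lookup σ) σπy≡y ⟩
        lookup σ y                       ∎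
        where
        open ≡-Reasoning
        σπy≡y : lookup σ (lookup π y) ≡ y
        σπy≡y = trans (sym (agree (lookup π y) (toℕ<n _) (λ h → <-asym y<πy (subst (lookup π y <_) (involutive π321 y) h))))
                      (involutive π321 y)
      ... | tri≈ ¬y<πy _ _ = agree y (toℕ<n y) ¬y<πy
      ... | tri> ¬y<πy _ _ = agree y (toℕ<n y) ¬y<πy

  opposite-< : ∀ {m} {i j : Fin m} → i < j → opposite j < opposite i
  opposite-< {i = i} {j} i<j rewrite opposite-prop i | opposite-prop j = ℕ.∸-monoʳ-< (s≤s i<j) (toℕ<n j)

  module _ {m : ℕ} where

    opener⇔opposite-closer : ∀ (π : Map m) → IsCentrosymmetric π → ∀ y →
                             Opener π y ⇔ lookup π (opposite y) < opposite y
    opener⇔opposite-closer π centro y = mk⇔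
      (λ y<πy → subst (_< opposite y) (sym (centro y)) (opposite-< y<πy))
      (λ πy′<y′ → subst₂ _<_ (opposite-involutive y) (opposite-involutive (lookup π y))
                             (opposite-< (subst (_< opposite y) (centro y) πy′<y′)))

    toInvolution321 : ∀ {π : Map m} → IsCInv321 π → Involution321 π
    toInvolution321 (perm , inv , _ , avoid) = record { injective = perm ; involutive = inv ; avoids321 = avoid }

    -- Centrosymmetry turns an opener y in the second half into a closer of the first half.
    centrosymmetric-same-openers⇒≡ : ∀ {π σ : Map m} n → IsCInv321 π → IsCInv321 σ →
      (∀ y → toℕ y ℕ.< n ⊎ toℕ (opposite y) ℕ.< n) → SameOpenersBelow n π σ → π ≡ σ
    centrosymmetric-same-openers⇒≡ {π} {σ} n πC σC halves same =
      same-openers⇒≡ π321 σ321 (λ y _ → sameAt y (halves y))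
      where
      π321 = toInvolution321 πC
      σ321 = toInvolution321 σC
      centroπ = proj₁ (proj₂ (proj₂ πC))
      centroσ = proj₁ (proj₂ (proj₂ σC))

      strict-closer : ∀ {τ ρ} → Involution321 τ → Involution321 ρ → SameOpenersBelow n τ ρ →
                      ∀ z → toℕ z ℕ.< n → lookup τ z < z → lookup ρ z < z
      strict-closer τ321 ρ321 sameτρ z z<n τz<z =
        subst (_< z) (closers-agree τ321 ρ321 n sameτρ z z<n (<-asym τz<z)) τz<z

      sameAt : ∀ y → toℕ y ℕ.< n ⊎ toℕ (opposite y) ℕ.< n → Opener π y ⇔ Opener σ y
      sameAt y (inj₁ y<n)  = same y y<n
      sameAt y (inj₂ y′<n) = mk⇔
        (λ π-opener → from (opener⇔opposite-closer σ centroσ y)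
          (strict-closer π321 σ321 same (opposite y) y′<n (to (opener⇔opposite-closer π centroπ y) π-opener)))
        (λ σ-opener → from (opener⇔opposite-closer π centroπ y)
          (strict-closer σ321 π321 (SameOpenersBelow-sym {π = π} {σ} same) (opposite y) y′<n
            (to (opener⇔opposite-closer σ centroσ y) σ-opener)))


module Paths where

  open import Defs
  open Words using (bit; bit-out)
  open Involutions using (Involution321)
  open import Data.Nat using (ℕ; zero; suc; _+_; _∸_; _≤_; _<_; z≤n; s≤s; z<s; pred)
  open import Data.Nat.Properties
  open import Data.Bool using (Bool; true; false; _∧_; not)
  open import Data.Bool.Properties using (¬-not)
  open import Data.Vec using (Vec; lookup; tabulate)
  open import Data.Vec.Properties using (lookup∘tabulate)
  open import Data.Fin using (toℕ; fromℕ<; opposite)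
  open import Data.Fin.Properties using (toℕ-injective; toℕ<n; toℕ-fromℕ<; opposite-prop)
  open import Data.Product using (_×_; _,_; proj₁; proj₂; map₂)
  open import Data.Sum using (_⊎_; inj₁; inj₂)
  open import Data.Empty using (⊥)
  open import Function using (_∘_; _⇔_; mk⇔; Equivalence)
  open import Relation.Nullary using (yes; no; contradiction)
  open import Relation.Binary.Definitions using (tri<; tri≈; tri>)
  open import Relation.Binary.PropositionalEquality
  open import Data.Nat.Tactic.RingSolver using (solve-∀)

  data Step : Set where
    up down flat : Step

  step-cases : ∀ s → s ≡ up ⊎ s ≡ down ⊎ s ≡ flat
  step-cases up   = inj₁ refl
  step-cases down = inj₂ (inj₁ refl)
  step-cases flat = inj₂ (inj₂ refl)

  mirror : Step → Step
  mirror up   = down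
  mirror down = up
  mirror flat = flat

  mirror-involutive : ∀ s → mirror (mirror s) ≡ s
  mirror-involutive up   = refl
  mirror-involutive down = refl
  mirror-involutive flat = refl

  χup χdown : Step → ℕ
  χup up     = 1
  χup _      = 0
  χdown down = 1
  χdown _    = 0

  χup-mirror : ∀ s → χup (mirror s) ≡ χdown s
  χup-mirror up   = refl
  χup-mirror down = refl
  χup-mirror flat = refl

  χdown-mirror : ∀ s → χdown (mirror s) ≡ χup s
  χdown-mirror up   = refl
  χdown-mirror down = refl
  χdown-mirror flat = refl

  suc-mono⇒mono : ∀ (f : ℕ → ℕ) → (∀ x → f x ≤ f (suc x)) → ∀ {x y} → x ≤ y → f x ≤ f y
  suc-mono⇒mono f f-suc {y = zero}  z≤n = ≤-refl
  suc-mono⇒mono f f-suc {y = suc y} x≤1+y with m≤n⇒m<n∨m≡n x≤1+y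
  ... | inj₁ x<1+y = ≤-trans (suc-mono⇒mono f f-suc (≤-pred x<1+y)) (f-suc y)
  ... | inj₂ refl  = ≤-refl

  m+n≡o+p∧o≤m⇒n≤p : ∀ {a b c e} → a + b ≡ c + e → c ≤ a → b ≤ e
  m+n≡o+p∧o≤m⇒n≤p {a} {b} {c} {e} eq c≤a = +-cancelˡ-≤ c b e (subst (c + b ≤_) eq (+-monoˡ-≤ b c≤a))

  module Counts (step : ℕ → Step) where

    ups downs : ℕ → ℕ
    ups   zero    = 0
    ups   (suc x) = ups x + χup (step x)
    downs zero    = 0
    downs (suc x) = downs x + χdown (step x)

    ups-mono : ∀ {x y} → x ≤ y → ups x ≤ ups y
    ups-mono = suc-mono⇒mono ups (λ x → m≤m+n (ups x) _)

    downs-mono : ∀ {x y} → x ≤ y → downs x ≤ downs y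
    downs-mono = suc-mono⇒mono downs (λ x → m≤m+n (downs x) _)

    ups-suc-up : ∀ {x} → step x ≡ up → ups (suc x) ≡ suc (ups x)
    ups-suc-up {x} up-x rewrite up-x = +-comm (ups x) 1

    downs-suc-down : ∀ {x} → step x ≡ down → downs (suc x) ≡ suc (downs x)
    downs-suc-down {x} down-x rewrite down-x = +-comm (downs x) 1

    ups-suc-flat : ∀ {x} → step x ≡ flat → ups (suc x) ≡ ups x
    ups-suc-flat {x} flat-x rewrite flat-x = +-identityʳ (ups x)

    downs-suc-flat : ∀ {x} → step x ≡ flat → downs (suc x) ≡ downs x
    downs-suc-flat {x} flat-x rewrite flat-x = +-identityʳ (downs x)

    up⇒ups-< : ∀ {x y} → step x ≡ up → x < y → ups x < ups y
    up⇒ups-< {y = y} up-x x<y = subst (_≤ ups y) (ups-suc-up up-x) (ups-mono x<y)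

    down⇒downs-< : ∀ {x y} → step x ≡ down → x < y → downs x < downs y
    down⇒downs-< {y = y} down-x x<y = subst (_≤ downs y) (downs-suc-down down-x) (downs-mono x<y)

    ups-<⇒< : ∀ {x y} → ups x < ups y → x < y
    ups-<⇒< {x} {y} ux<uy with x <? y
    ... | yes x<y = x<y
    ... | no  x≮y = contradiction (ups-mono (≮⇒≥ x≮y)) (<⇒≱ ux<uy)

    downs-<⇒< : ∀ {x y} → downs x < downs y → x < y
    downs-<⇒< {x} {y} dx<dy with x <? y
    ... | yes x<y = x<y
    ... | no  x≮y = contradiction (downs-mono (≮⇒≥ x≮y)) (<⇒≱ dx<dy)

    ups-injective : ∀ {a b} → step a ≡ up → step b ≡ up → ups a ≡ ups b → a ≡ b
    ups-injective {a} {b} up-a up-b ua≡ub with <-cmp a b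
    ... | tri< a<b _ _ = contradiction ua≡ub (<⇒≢ (up⇒ups-< up-a a<b))
    ... | tri≈ _ a≡b _ = a≡b
    ... | tri> _ _ b<a = contradiction (sym ua≡ub) (<⇒≢ (up⇒ups-< up-b b<a))

    downs-injective : ∀ {a b} → step a ≡ down → step b ≡ down → downs a ≡ downs b → a ≡ b
    downs-injective {a} {b} down-a down-b da≡db with <-cmp a b
    ... | tri< a<b _ _ = contradiction da≡db (<⇒≢ (down⇒downs-< down-a a<b))
    ... | tri≈ _ a≡b _ = a≡b
    ... | tri> _ _ b<a = contradiction (sym da≡db) (<⇒≢ (down⇒downs-< down-b b<a))

    findDown findUp : ℕ → ℕ → ℕ
    findDown zero    k = 0
    findDown (suc x) k with step x | downs x ≟ k
    ... | down | yes _ = x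
    ... | _    | _     = findDown x k
    findUp zero    k = 0
    findUp (suc x) k with step x | ups x ≟ k
    ... | up | yes _ = x
    ... | _  | _     = findUp x k

    findDown-spec : ∀ x k → k < downs x → step (findDown x k) ≡ down × downs (findDown x k) ≡ k × findDown x k < x
    findDown-spec (suc x) k k<dx with step x in step-x | downs x ≟ k
    ... | down | yes dx≡k = step-x , dx≡k , n<1+n x
    ... | down | no  dx≢k = map₂ (map₂ m<n⇒m<1+n) (findDown-spec x k (≤∧≢⇒< (≤-pred (subst (k <_) (+-comm (downs x) 1) k<dx)) (dx≢k ∘ sym)))
    ... | up   | _        = map₂ (map₂ m<n⇒m<1+n) (findDown-spec x k (subst (k <_) (+-identityʳ (downs x)) k<dx))
    ... | flat | _        = map₂ (map₂ m<n⇒m<1+n) (findDown-spec x k (subst (k <_) (+-identityʳ (downs x)) k<dx))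

    findUp-spec : ∀ x k → k < ups x → step (findUp x k) ≡ up × ups (findUp x k) ≡ k × findUp x k < x
    findUp-spec (suc x) k k<ux with step x in step-x | ups x ≟ k
    ... | up   | yes ux≡k = step-x , ux≡k , n<1+n x
    ... | up   | no  ux≢k = map₂ (map₂ m<n⇒m<1+n) (findUp-spec x k (≤∧≢⇒< (≤-pred (subst (k <_) (+-comm (ups x) 1) k<ux)) (ux≢k ∘ sym)))
    ... | down | _        = map₂ (map₂ m<n⇒m<1+n) (findUp-spec x k (subst (k <_) (+-identityʳ (ups x)) k<ux))
    ... | flat | _        = map₂ (map₂ m<n⇒m<1+n) (findUp-spec x k (subst (k <_) (+-identityʳ (ups x)) k<ux))

  -- The arc diagram of a Motzkin path whose flat steps lie on the ground: the up step preceded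
  -- by k up steps is matched with the down step preceded by k down steps, flat steps are fixed.
  module Matching (step : ℕ → Step) (m : ℕ)
    (balanced    : Counts.downs step m ≡ Counts.ups step m)
    (ballot      : ∀ x → x ≤ m → Counts.downs step x ≤ Counts.ups step x)
    (down-above  : ∀ x → x < m → step x ≡ down → Counts.downs step x < Counts.ups step x)
    (flat-ground : ∀ x → x < m → step x ≡ flat → Counts.downs step x ≡ Counts.ups step x) where

    open Counts step

    partner : ℕ → ℕ
    partner i with step i
    ... | up   = findDown m (ups i)
    ... | down = findUp m (downs i)
    ... | flat = i

    partner-up : ∀ {i} → step i ≡ up → partner i ≡ findDown m (ups i)
    partner-up {i} up-i with step i
    ... | up = refl

    partner-down : ∀ {i} → step i ≡ down → partner i ≡ findUp m (downs i)
    partner-down {i} down-i with step i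
    ... | down = refl

    partner-flat : ∀ {i} → step i ≡ flat → partner i ≡ i
    partner-flat {i} flat-i with step i
    ... | flat = refl

    record UpMatch (i j : ℕ) : Set where
      field
        closer-down   : step j ≡ down
        closer-level  : downs j ≡ ups i
        closer<m      : j < m
        opener<closer : i < j

    record DownMatch (i j : ℕ) : Set where
      field
        opener-up     : step j ≡ up
        opener-level  : ups j ≡ downs i
        opener<m      : j < m
        opener<closer : j < i

    open UpMatch public
    open DownMatch public

    partner-of-up : ∀ {i} → i < m → step i ≡ up → UpMatch i (partner i)
    partner-of-up {i} i<m up-i rewrite partner-up up-i = record
      { closer-down = down-j ; closer-level = level ; closer<m = j<m ; opener<closer = i<j }
      where
      j = findDown m (ups i)
      spec = findDown-spec m (ups i) (subst (ups i <_) (sym balanced) (up⇒ups-< up-i i<m))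
      down-j = proj₁ spec
      level = proj₁ (proj₂ spec)
      j<m = proj₂ (proj₂ spec)
      i<j : i < j
      i<j with <-cmp i j
      ... | tri< i<j _ _ = i<j
      ... | tri≈ _ i≡j _ = contradiction (trans (sym up-i) (trans (cong step i≡j) down-j)) λ ()
      ... | tri> _ _ j<i = contradiction (ballot i (<⇒≤ i<m))
            (<⇒≱ (subst (_≤ downs i) (trans (downs-suc-down down-j) (cong suc level)) (downs-mono j<i)))

    partner-of-down : ∀ {i} → i < m → step i ≡ down → DownMatch i (partner i)
    partner-of-down {i} i<m down-i rewrite partner-down down-i = record
      { opener-up = up-j ; opener-level = level ; opener<m = j<m ; opener<closer = j<i }
      where
      j = findUp m (downs i)
      spec = findUp-spec m (downs i) (subst (downs i <_) balanced (down⇒downs-< down-i i<m))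
      up-j = proj₁ spec
      level = proj₁ (proj₂ spec)
      j<m = proj₂ (proj₂ spec)
      j<i : j < i
      j<i with <-cmp j i
      ... | tri< j<i _ _ = j<i
      ... | tri≈ _ j≡i _ = contradiction (trans (sym up-j) (trans (cong step j≡i) down-i)) λ ()
      ... | tri> _ _ i<j = contradiction (subst (ups i ≤_) level (ups-mono (<⇒≤ i<j))) (<⇒≱ (down-above i i<m down-i))

    partner<m : ∀ {i} → i < m → partner i < m
    partner<m {i} i<m with step-cases (step i)
    ... | inj₁ up-i          = closer<m (partner-of-up i<m up-i)
    ... | inj₂ (inj₁ down-i) = opener<m (partner-of-down i<m down-i)
    ... | inj₂ (inj₂ flat-i) = subst (_< m) (sym (partner-flat flat-i)) i<m

    partner-involutive : ∀ {i} → i < m → partner (partner i) ≡ i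
    partner-involutive {i} i<m with step-cases (step i)
    ... | inj₁ up-i =
      let j = partner-of-up i<m up-i
          i′ = partner-of-down (closer<m j) (closer-down j)
      in ups-injective (opener-up i′) up-i (trans (opener-level i′) (closer-level j))
    ... | inj₂ (inj₁ down-i) =
      let j = partner-of-down i<m down-i
          i′ = partner-of-up (opener<m j) (opener-up j)
      in downs-injective (closer-down i′) down-i (trans (closer-level i′) (opener-level j))
    ... | inj₂ (inj₂ flat-i) = trans (cong partner (partner-flat flat-i)) (partner-flat flat-i)

    ¬down-cases : ∀ s → s ≢ down → s ≡ up ⊎ s ≡ flat
    ¬down-cases up   _       = inj₁ refl
    ¬down-cases down s≢down = contradiction refl s≢down
    ¬down-cases flat _       = inj₂ refl

    down? : ∀ s → s ≡ down ⊎ s ≢ down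
    down? up   = inj₂ λ ()
    down? down = inj₁ refl
    down? flat = inj₂ λ ()

    ¬down⇒≤partner : ∀ {a} → a < m → step a ≢ down → a ≤ partner a
    ¬down⇒≤partner {a} a<m ¬down-a with ¬down-cases (step a) ¬down-a
    ... | inj₁ up-a   = <⇒≤ (opener<closer (partner-of-up a<m up-a))
    ... | inj₂ flat-a = ≤-reflexive (sym (partner-flat flat-a))

    ¬down-partners-increasing : ∀ {a b} → a < b → b < m → step a ≢ down → step b ≢ down → partner a < partner b
    ¬down-partners-increasing {a} {b} a<b b<m ¬down-a ¬down-b
      with ¬down-cases (step a) ¬down-a | ¬down-cases (step b) ¬down-b
    ... | inj₁ up-a | inj₁ up-b = downs-<⇒< (subst₂ _<_
            (sym (closer-level (partner-of-up (<-trans a<b b<m) up-a))) (sym (closer-level (partner-of-up b<m up-b)))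
            (up⇒ups-< up-a a<b))
    ... | inj₁ up-a | inj₂ flat-b = subst (partner a <_) (sym (partner-flat flat-b)) (downs-<⇒< (subst₂ _<_
            (sym (closer-level (partner-of-up (<-trans a<b b<m) up-a))) (sym (flat-ground b b<m flat-b))
            (up⇒ups-< up-a a<b)))
    ... | inj₂ flat-a | inj₁ up-b = subst (_< partner b) (sym (partner-flat flat-a))
            (<-trans a<b (opener<closer (partner-of-up b<m up-b)))
    ... | inj₂ flat-a | inj₂ flat-b = subst₂ _<_ (sym (partner-flat flat-a)) (sym (partner-flat flat-b)) a<b

    down-partners-increasing : ∀ {a b} → a < b → b < m → step a ≡ down → step b ≡ down → partner a < partner b
    down-partners-increasing {a} {b} a<b b<m down-a down-b = ups-<⇒< (subst₂ _<_
      (sym (opener-level (partner-of-down (<-trans a<b b<m) down-a))) (sym (opener-level (partner-of-down b<m down-b)))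
      (down⇒downs-< down-a a<b))

    -- Among any three positions two are of the same kind (down or not), and partners increase on each kind.
    partner-avoids321 : ∀ {a b c} → a < b → b < c → c < m → partner b < partner a → partner c < partner b → ⊥
    partner-avoids321 {a} {b} {c} a<b b<c c<m pb<pa pc<pb with down? (step a) | down? (step b) | down? (step c)
    ... | inj₁ da | inj₁ db | _      = <-asym pb<pa (down-partners-increasing a<b (<-trans b<c c<m) da db)
    ... | inj₂ na | inj₂ nb | _      = <-asym pb<pa (¬down-partners-increasing a<b (<-trans b<c c<m) na nb)
    ... | _       | inj₁ db | inj₁ dc = <-asym pc<pb (down-partners-increasing b<c c<m db dc)
    ... | _       | inj₂ nb | inj₂ nc = <-asym pc<pb (¬down-partners-increasing b<c c<m nb nc)
    ... | inj₁ da | inj₂ _  | inj₁ dc = <-asym (<-trans pc<pb pb<pa) (down-partners-increasing (<-trans a<b b<c) c<m da dc)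
    ... | inj₂ na | inj₁ _  | inj₂ nc = <-asym (<-trans pc<pb pb<pa) (¬down-partners-increasing (<-trans a<b b<c) c<m na nc)

    flat-then-¬down : ∀ {x} → suc x < m → step x ≡ flat → step (suc x) ≢ down
    flat-then-¬down {x} 1+x<m flat-x down-1+x = <-irrefl (flat-ground x (<-trans (n<1+n x) 1+x<m) flat-x)
      (subst₂ _<_ (downs-suc-flat flat-x) (ups-suc-flat flat-x) (down-above (suc x) 1+x<m down-1+x))

    opener⇔up : ∀ {i} → i < m → i < partner i ⇔ step i ≡ up
    opener⇔up {i} i<m = mk⇔ opener⇒up (opener<closer ∘ partner-of-up i<m)
      where
      opener⇒up : i < partner i → step i ≡ up
      opener⇒up i<pi with step-cases (step i)
      ... | inj₁ up-i          = up-i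
      ... | inj₂ (inj₁ down-i) = contradiction (opener<closer (partner-of-down i<m down-i)) (<-asym i<pi)
      ... | inj₂ (inj₂ flat-i) = contradiction (sym (partner-flat flat-i)) (<⇒≢ i<pi)

    descent⇔up-then-¬up : ∀ {x} → suc x < m → partner (suc x) < partner x ⇔ (step x ≡ up × step (suc x) ≢ up)
    descent⇔up-then-¬up {x} 1+x<m = mk⇔ descent⇒ descent⇐
      where
      x<m = <-trans (n<1+n x) 1+x<m
      x<1+x = n<1+n x

      descent⇐ : step x ≡ up × step (suc x) ≢ up → partner (suc x) < partner x
      descent⇐ (up-x , ¬up-1+x) with step-cases (step (suc x))
      ... | inj₁ up-1+x          = contradiction up-1+x ¬up-1+x
      ... | inj₂ (inj₁ down-1+x) = <-≤-trans (opener<closer (partner-of-down 1+x<m down-1+x))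
                                               (opener<closer (partner-of-up x<m up-x))
      ... | inj₂ (inj₂ flat-1+x) = subst (_< partner x) (sym (partner-flat flat-1+x))
                                     (≤∧≢⇒< (opener<closer (partner-of-up x<m up-x)) 1+x≢px)
        where
        1+x≢px : suc x ≢ partner x
        1+x≢px 1+x≡px = <-irrefl (trans (sym (partner-involutive x<m)) (trans (cong partner (sym 1+x≡px)) (partner-flat flat-1+x)))
                                 x<1+x

      descent⇒ : partner (suc x) < partner x → step x ≡ up × step (suc x) ≢ up
      descent⇒ p1+x<px with step-cases (step x) | down? (step (suc x))
      ... | inj₁ up-x | _ = up-x , λ up-1+x →
        <-asym p1+x<px (¬down-partners-increasing x<1+x 1+x<m (λ down-x → contradiction (trans (sym up-x) down-x) λ ())
                                                               (λ down-1+x → contradiction (trans (sym up-1+x) down-1+x) λ ()))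
      ... | inj₂ (inj₁ down-x) | inj₁ down-1+x = contradiction (down-partners-increasing x<1+x 1+x<m down-x down-1+x) (<-asym p1+x<px)
      ... | inj₂ (inj₁ down-x) | inj₂ ¬down-1+x = contradiction
            (<-trans (opener<closer (partner-of-down x<m down-x)) (<-≤-trans x<1+x (¬down⇒≤partner 1+x<m ¬down-1+x)))
            (<-asym p1+x<px)
      ... | inj₂ (inj₂ flat-x) | inj₁ down-1+x = contradiction down-1+x (flat-then-¬down 1+x<m flat-x)
      ... | inj₂ (inj₂ flat-x) | inj₂ ¬down-1+x = contradiction
            (subst (_< partner (suc x)) (sym (partner-flat flat-x)) (<-≤-trans x<1+x (¬down⇒≤partner 1+x<m ¬down-1+x)))
            (<-asym p1+x<px)

    encode : Map m
    encode = tabulate (λ i → fromℕ< (partner<m (toℕ<n i)))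

    toℕ-encode : ∀ i → toℕ (lookup encode i) ≡ partner (toℕ i)
    toℕ-encode i = trans (cong toℕ (lookup∘tabulate _ i)) (toℕ-fromℕ< _)

    encode-involution321 : Involution321 encode
    encode-involution321 = record { injective = injective ; involutive = involutive ; avoids321 = avoids321 }
      where
      involutive : IsInvolution encode
      involutive i = toℕ-injective (begin
        toℕ (lookup encode (lookup encode i))  ≡⟨ toℕ-encode (lookup encode i) ⟩
        partner (toℕ (lookup encode i))        ≡⟨ cong partner (toℕ-encode i) ⟩
        partner (partner (toℕ i))              ≡⟨ partner-involutive (toℕ<n i) ⟩
        toℕ i                                  ∎)
        where open ≡-Reasoning
      injective : IsPerm encode
      injective i j ei≡ej = trans (sym (involutive i)) (trans (cong (lookup encode) ei≡ej) (involutive j))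
      avoids321 : Avoids321 encode
      avoids321 i j k (i<j , j<k , ej<ei , ek<ej) = partner-avoids321 i<j j<k (toℕ<n k)
        (subst₂ _<_ (toℕ-encode j) (toℕ-encode i) ej<ei) (subst₂ _<_ (toℕ-encode k) (toℕ-encode j) ek<ej)

    encode-opener⇔up : ∀ y → toℕ y < toℕ (lookup encode y) ⇔ step (toℕ y) ≡ up
    encode-opener⇔up y = subst (λ p → toℕ y < p ⇔ step (toℕ y) ≡ up) (sym (toℕ-encode y)) (opener⇔up (toℕ<n y))

    encode-descent⇔ : ∀ {k} → suc k < m → IsDescent encode (suc k) ⇔ partner (suc k) < partner k
    encode-descent⇔ {k} 1+k<m = mk⇔
      (λ { (a , b , a+1≡1+k , b≡1+k , eb<ea) → subst₂ _<_
             (trans (toℕ-encode b) (cong partner b≡1+k))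
             (trans (toℕ-encode a) (cong partner (suc-injective (trans (+-comm 1 (toℕ a)) a+1≡1+k))))
             eb<ea })
      (λ p1+k<pk → fromℕ< k<m , fromℕ< 1+k<m ,
         trans (cong (_+ 1) (toℕ-fromℕ< k<m)) (+-comm k 1) , toℕ-fromℕ< 1+k<m ,
         subst₂ _<_ (sym (trans (toℕ-encode _) (cong partner (toℕ-fromℕ< 1+k<m))))
                    (sym (trans (toℕ-encode _) (cong partner (toℕ-fromℕ< k<m)))) p1+k<pk)
      where
      k<m = <-trans (n<1+n k) 1+k<m

  module Reflection (n m : ℕ) (m≡n+n : m ≡ n + n) where

    m∸n≡n : m ∸ n ≡ n
    m∸n≡n = trans (cong (_∸ n) m≡n+n) (m+n∸n≡m n n)

    i<n⇒n≤m∸1+i : ∀ {i} → i < n → n ≤ m ∸ suc i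
    i<n⇒n≤m∸1+i {i} i<n rewrite m≡n+n | +-∸-assoc n i<n = m≤m+n n _

    n≤i⇒m∸1+i<n : ∀ {i} → n ≤ i → i < m → m ∸ suc i < n
    n≤i⇒m∸1+i<n n≤i i<m = subst (_ <_) m∸n≡n (∸-monoʳ-< (s≤s n≤i) i<m)

    m∸1+i<m : ∀ {i} → i < m → m ∸ suc i < m
    m∸1+i<m = ∸-monoʳ-< z<s

    m∸1+[m∸1+i]≡i : ∀ {i} → i < m → m ∸ suc (m ∸ suc i) ≡ i
    m∸1+[m∸1+i]≡i i<m = trans (cong (m ∸_) (sym (+-∸-assoc 1 i<m))) (m∸[m∸n]≡n (<⇒≤ i<m))

    1+i≤n⇒1+i<m : ∀ {i} → suc i ≤ n → suc i < m
    1+i≤n⇒1+i<m {i} 1+i≤n = subst (suc i <_) (sym m≡n+n) (≤-<-trans 1+i≤n (m<m+n n (≤-trans z<s 1+i≤n)))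

  move : Bool → ℕ → ℕ
  move true  h = suc h
  move false h = pred h

  -- A 0 at height 0 becomes a flat step, which is why the path stays above the ground.
  classify : Bool → ℕ → Step
  classify true  _       = up
  classify false zero    = flat
  classify false (suc _) = down

  classify-move-balance : ∀ b h {d u} → d + h ≡ u → d + χdown (classify b h) + move b h ≡ u + χup (classify b h)
  classify-move-balance true  h       {d} refl = solve-∀′ d h
    where solve-∀′ : ∀ d h → d + 0 + suc h ≡ d + h + 1
          solve-∀′ = solve-∀
  classify-move-balance false zero    {d} refl = refl
  classify-move-balance false (suc h) {d} refl = solve-∀′ d h
    where solve-∀′ : ∀ d h → d + 1 + h ≡ d + suc h + 0
          solve-∀′ = solve-∀

  classify≡up : ∀ {b h} → classify b h ≡ up → b ≡ true
  classify≡up {true} _ = refl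
  classify≡up {false} {zero} ()
  classify≡up {false} {suc _} ()

  classify≡down : ∀ {b h} → classify b h ≡ down → 0 < h
  classify≡down {false} {suc h} _ = z<s

  classify≡flat : ∀ {b h} → classify b h ≡ flat → h ≡ 0
  classify≡flat {false} {zero} _ = refl

  ∧-not≡true⇔ : ∀ {a b} → (a ∧ not b) ≡ true ⇔ (a ≡ true × b ≡ false)
  ∧-not≡true⇔ {true}  {false} = mk⇔ (λ _ → refl , refl) (λ _ → refl)
  ∧-not≡true⇔ {true}  {true}  = mk⇔ (λ ()) (λ ())
  ∧-not≡true⇔ {false} {_}     = mk⇔ (λ ()) (λ ())

  module Path (n : ℕ) (c : Vec Bool n) (m : ℕ) (m≡n+n : m ≡ n + n) where

    open Reflection n m m≡n+n

    β : ℕ → Bool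
    β = bit c

    height : ℕ → ℕ
    height zero    = 0
    height (suc i) = move (β i) (height i)

    halfStep : ℕ → Step
    halfStep i = classify (β i) (height i)

    step : ℕ → Step
    step i with i <? n
    ... | yes _ = halfStep i
    ... | no  _ = mirror (halfStep (m ∸ suc i))

    step-firstHalf : ∀ {i} → i < n → step i ≡ halfStep i
    step-firstHalf {i} i<n with i <? n
    ... | yes _   = refl
    ... | no  i≮n = contradiction i<n i≮n

    step-secondHalf : ∀ {i} → n ≤ i → step i ≡ mirror (halfStep (m ∸ suc i))
    step-secondHalf {i} n≤i with i <? n
    ... | yes i<n = contradiction n≤i (<⇒≱ i<n)
    ... | no  _   = refl

    step-mirror : ∀ {i} → i < m → step (m ∸ suc i) ≡ mirror (step i)
    step-mirror {i} i<m with i <? n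
    ... | yes i<n = trans (step-secondHalf (i<n⇒n≤m∸1+i i<n)) (cong (mirror ∘ halfStep) (m∸1+[m∸1+i]≡i i<m))
    ... | no  i≮n = trans (step-firstHalf (n≤i⇒m∸1+i<n (≮⇒≥ i≮n) i<m)) (sym (mirror-involutive _))

    open Counts step

    downs+height≡ups : ∀ x → x ≤ n → downs x + height x ≡ ups x
    downs+height≡ups zero    _     = refl
    downs+height≡ups (suc x) 1+x≤n rewrite step-firstHalf 1+x≤n =
      classify-move-balance (β x) (height x) (downs+height≡ups x (<⇒≤ 1+x≤n))

    ups-reflect : ∀ x → x ≤ m → ups (m ∸ x) + downs x ≡ ups m
    ups-reflect zero    _     = +-identityʳ (ups m)
    ups-reflect (suc x) 1+x≤m = begin
      ups (m ∸ suc x) + (downs x + χdown (step x))      ≡⟨ swap-last (ups (m ∸ suc x)) (downs x) _ ⟩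
      ups (m ∸ suc x) + χdown (step x) + downs x        ≡⟨ cong (λ s → ups (m ∸ suc x) + s + downs x) (χup-mirror (step x)) ⟨
      ups (m ∸ suc x) + χup (mirror (step x)) + downs x ≡⟨ cong (λ s → ups (m ∸ suc x) + χup s + downs x) (step-mirror 1+x≤m) ⟨
      ups (suc (m ∸ suc x)) + downs x                   ≡⟨ cong (λ k → ups k + downs x) (+-∸-assoc 1 1+x≤m) ⟨
      ups (m ∸ x) + downs x                             ≡⟨ ups-reflect x (<⇒≤ 1+x≤m) ⟩
      ups m                                             ∎
      where
      open ≡-Reasoning
      swap-last : ∀ a b c → a + (b + c) ≡ a + c + b
      swap-last = solve-∀

    downs-reflect : ∀ x → x ≤ m → downs (m ∸ x) + ups x ≡ downs m
    downs-reflect zero    _     = +-identityʳ (downs m)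
    downs-reflect (suc x) 1+x≤m = begin
      downs (m ∸ suc x) + (ups x + χup (step x))          ≡⟨ swap-last (downs (m ∸ suc x)) (ups x) _ ⟩
      downs (m ∸ suc x) + χup (step x) + ups x            ≡⟨ cong (λ s → downs (m ∸ suc x) + s + ups x) (χdown-mirror (step x)) ⟨
      downs (m ∸ suc x) + χdown (mirror (step x)) + ups x ≡⟨ cong (λ s → downs (m ∸ suc x) + χdown s + ups x) (step-mirror 1+x≤m) ⟨
      downs (suc (m ∸ suc x)) + ups x                     ≡⟨ cong (λ k → downs k + ups x) (+-∸-assoc 1 1+x≤m) ⟨
      downs (m ∸ x) + ups x                               ≡⟨ downs-reflect x (<⇒≤ 1+x≤m) ⟩
      downs m                                             ∎
      where
      open ≡-Reasoning
      swap-last : ∀ a b c → a + (b + c) ≡ a + c + b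
      swap-last = solve-∀

    balanced : downs m ≡ ups m
    balanced = trans (cong (λ k → ups k + downs m) (sym (n∸n≡0 m))) (ups-reflect m ≤-refl)

    ups-downs-reflect : ∀ x → x ≤ m → ups (m ∸ x) + downs x ≡ downs (m ∸ x) + ups x
    ups-downs-reflect x x≤m = trans (ups-reflect x x≤m) (trans (sym balanced) (sym (downs-reflect x x≤m)))

    ballot-firstHalf : ∀ x → x ≤ n → downs x ≤ ups x
    ballot-firstHalf x x≤n = subst (downs x ≤_) (downs+height≡ups x x≤n) (m≤m+n (downs x) (height x))

    ballot : ∀ x → x ≤ m → downs x ≤ ups x
    ballot x x≤m with x ≤? n
    ... | yes x≤n = ballot-firstHalf x x≤n
    ... | no  x≰n = m+n≡o+p∧o≤m⇒n≤p (ups-downs-reflect x x≤m)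
                      (ballot-firstHalf (m ∸ x) (subst (m ∸ x ≤_) m∸n≡n (∸-monoʳ-≤ m (<⇒≤ (≰⇒> x≰n)))))

    -- In the second half, both facts are read off the mirror step m − 1 − x of the first half.
    down-above : ∀ x → x < m → step x ≡ down → downs x < ups x
    down-above x x<m down-x with n ≤? x
    ... | no  n≰x = subst₂ _<_ (+-identityʳ (downs x)) (downs+height≡ups x (<⇒≤ x<n))
                      (+-monoʳ-< (downs x) (classify≡down halfStep-down))
      where
      x<n = ≰⇒> n≰x
      halfStep-down = trans (sym (step-firstHalf x<n)) down-x
    ... | yes n≤x = subst₂ _≤_ (+-comm (downs x) 1) (+-identityʳ (ups x))
                      (m+n≡o+p∧o≤m⇒n≤p reflected (ballot-firstHalf (m ∸ suc x) (<⇒≤ (n≤i⇒m∸1+i<n n≤x x<m))))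
      where
      reflected : ups (m ∸ suc x) + (downs x + 1) ≡ downs (m ∸ suc x) + (ups x + 0)
      reflected = subst (λ s → ups (m ∸ suc x) + (downs x + χdown s) ≡ downs (m ∸ suc x) + (ups x + χup s))
                        down-x (ups-downs-reflect (suc x) x<m)

    flat-ground-firstHalf : ∀ x → x < n → step x ≡ flat → downs x ≡ ups x
    flat-ground-firstHalf x x<n flat-x = begin
      downs x              ≡⟨ +-identityʳ (downs x) ⟨
      downs x + 0          ≡⟨ cong (downs x +_) (classify≡flat (trans (sym (step-firstHalf x<n)) flat-x)) ⟨
      downs x + height x   ≡⟨ downs+height≡ups x (<⇒≤ x<n) ⟩
      ups x                ∎
      where open ≡-Reasoning

    flat-ground : ∀ x → x < m → step x ≡ flat → downs x ≡ ups x
    flat-ground x x<m flat-x with n ≤? x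
    ... | no  n≰x = flat-ground-firstHalf x (≰⇒> n≰x) flat-x
    ... | yes n≤x = +-cancelˡ-≡ (ups x′) (downs x) (ups x) (begin
      ups x′ + downs x           ≡⟨ cong (ups x′ +_) (+-identityʳ (downs x)) ⟨
      ups x′ + (downs x + 0)     ≡⟨ reflected ⟩
      downs x′ + (ups x + 0)     ≡⟨ cong₂ _+_ (flat-ground-firstHalf x′ x′<n flat-x′) (+-identityʳ (ups x)) ⟩
      ups x′ + ups x             ∎)
      where
      open ≡-Reasoning
      x′ = m ∸ suc x
      x′<n = n≤i⇒m∸1+i<n n≤x x<m
      flat-x′ : step x′ ≡ flat
      flat-x′ = trans (step-mirror x<m) (cong mirror flat-x)
      reflected : ups x′ + (downs x + 0) ≡ downs x′ + (ups x + 0)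
      reflected = subst (λ s → ups x′ + (downs x + χdown s) ≡ downs x′ + (ups x + χup s)) flat-x (ups-downs-reflect (suc x) x<m)

    open Matching step m balanced ballot down-above flat-ground public

    partner-mirror : ∀ {i} → i < m → partner (m ∸ suc i) ≡ m ∸ suc (partner i)
    partner-mirror {i} i<m with step-cases (step i)
    ... | inj₁ up-i = ups-injective (opener-up i′) up-j′ (+-cancelʳ-≡ (suc (ups i)) _ _ (begin
      ups (partner (m ∸ suc i)) + suc (ups i) ≡⟨ cong (_+ suc (ups i)) (opener-level i′) ⟩
      downs (m ∸ suc i) + suc (ups i)        ≡⟨ cong (downs (m ∸ suc i) +_) (ups-suc-up up-i) ⟨
      downs (m ∸ suc i) + ups (suc i)        ≡⟨ trans (downs-reflect (suc i) i<m) balanced ⟩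
      ups m                                  ≡⟨ ups-reflect (suc j) (closer<m jm) ⟨
      ups (m ∸ suc j) + downs (suc j)        ≡⟨ cong (ups (m ∸ suc j) +_) (trans (downs-suc-down (closer-down jm)) (cong suc (closer-level jm))) ⟩
      ups (m ∸ suc j) + suc (ups i)          ∎))
      where
      open ≡-Reasoning
      jm = partner-of-up i<m up-i
      j = partner i
      i′ = partner-of-down (m∸1+i<m i<m) (trans (step-mirror i<m) (cong mirror up-i))
      up-j′ = trans (step-mirror (closer<m jm)) (cong mirror (closer-down jm))
    ... | inj₂ (inj₁ down-i) = downs-injective (closer-down i′) down-j′ (+-cancelʳ-≡ (suc (downs i)) _ _ (begin
      downs (partner (m ∸ suc i)) + suc (downs i) ≡⟨ cong (_+ suc (downs i)) (closer-level i′) ⟩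
      ups (m ∸ suc i) + suc (downs i)            ≡⟨ cong (ups (m ∸ suc i) +_) (downs-suc-down down-i) ⟨
      ups (m ∸ suc i) + downs (suc i)            ≡⟨ ups-reflect (suc i) i<m ⟩
      ups m                                      ≡⟨ trans (downs-reflect (suc j) (opener<m jm)) balanced ⟨
      downs (m ∸ suc j) + ups (suc j)            ≡⟨ cong (downs (m ∸ suc j) +_) (trans (ups-suc-up (opener-up jm)) (cong suc (opener-level jm))) ⟩
      downs (m ∸ suc j) + suc (downs i)          ∎))
      where
      open ≡-Reasoning
      jm = partner-of-down i<m down-i
      j = partner i
      i′ = partner-of-up (m∸1+i<m i<m) (trans (step-mirror i<m) (cong mirror down-i))
      down-j′ = trans (step-mirror (opener<m jm)) (cong mirror (opener-up jm))
    ... | inj₂ (inj₂ flat-i) =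
      trans (partner-flat (trans (step-mirror i<m) (cong mirror flat-i))) (cong (λ k → m ∸ suc k) (sym (partner-flat flat-i)))

    encode-CInv321 : IsCInv321 encode
    encode-CInv321 = injective , involutive , centrosymmetric , avoids321
      where
      open Involution321 encode-involution321
      centrosymmetric : IsCentrosymmetric encode
      centrosymmetric i = toℕ-injective (begin
        toℕ (lookup encode (opposite i))   ≡⟨ toℕ-encode (opposite i) ⟩
        partner (toℕ (opposite i))         ≡⟨ cong partner (opposite-prop i) ⟩
        partner (m ∸ suc (toℕ i))          ≡⟨ partner-mirror (toℕ<n i) ⟩
        m ∸ suc (partner (toℕ i))          ≡⟨ cong (λ k → m ∸ suc k) (toℕ-encode i) ⟨
        m ∸ suc (toℕ (lookup encode i))    ≡⟨ opposite-prop (lookup encode i) ⟨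
        toℕ (opposite (lookup encode i))   ∎)
        where open ≡-Reasoning

    up⇔bit : ∀ {x} → x < n → step x ≡ up ⇔ β x ≡ true
    up⇔bit {x} x<n = mk⇔ (λ up-x → classify≡up (trans (sym (step-firstHalf x<n)) up-x))
                         (λ βx → trans (step-firstHalf x<n) (cong (λ b → classify b (height x)) βx))

    up-then-¬up⇔bits : ∀ {x} → suc x ≤ n → (step x ≡ up × step (suc x) ≢ up) ⇔ (β x ∧ not (β (suc x))) ≡ true
    up-then-¬up⇔bits {x} 1+x≤n = mk⇔
      (λ (up-x , ¬up-1+x) → Equivalence.from ∧-not≡true⇔ (Equivalence.to (up⇔bit 1+x≤n) up-x , next-bit ¬up-1+x))
      (λ bits → let (βx , ¬β1+x) = Equivalence.to ∧-not≡true⇔ bits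
                    up-x = Equivalence.from (up⇔bit 1+x≤n) βx
                in up-x , next-step up-x ¬β1+x)
      where
      next-bit : step (suc x) ≢ up → β (suc x) ≡ false
      next-bit ¬up-1+x with m≤n⇒m<n∨m≡n 1+x≤n
      ... | inj₁ 1+x<n = ¬-not (¬up-1+x ∘ Equivalence.from (up⇔bit 1+x<n))
      ... | inj₂ refl  = bit-out c ≤-refl
      -- At the middle, step n mirrors step n − 1.
      next-step : step x ≡ up → β (suc x) ≡ false → step (suc x) ≢ up
      next-step up-x ¬β1+x up-1+x with m≤n⇒m<n∨m≡n 1+x≤n
      ... | inj₁ 1+x<n = contradiction (trans (sym ¬β1+x) (Equivalence.to (up⇔bit 1+x<n) up-1+x)) λ ()
      ... | inj₂ refl  = contradiction (trans (sym up-1+x) (trans (cong step (sym m∸n≡n)) (trans (step-mirror x<m) (cong mirror up-x)))) λ ()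
        where x<m = <-trans (n<1+n x) (1+i≤n⇒1+i<m 1+x≤n)


open import Defs
open Sums
open Words
open Enumeration
open Involutions
open Paths
open import Data.Nat as ℕ using (ℕ; suc; _≤_; _*_; _∸_; _<ᵇ_)
import Data.Nat.Properties as ℕ
open import Data.Nat.DivMod using (_/_; m*n/n≡m)
open import Data.Nat.ListAction using (sum)
open import Data.Integer using (ℤ; _+_; _-_; 1ℤ; 0ℤ) renaming (_*_ to _*ℤ_; _^_ to _^ℤ_)
open import Data.Bool using (Bool; true; _∧_; not)
open import Data.Bool.Properties using (T-≡; ⇔→≡)
open import Data.Vec using (Vec; lookup)
open import Data.Fin using (Fin; toℕ; fromℕ<; opposite)
open import Data.Fin.Properties using (toℕ<n; toℕ-fromℕ<; fromℕ<-toℕ; opposite-prop)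
open import Data.List using (map; foldr; filter)
open import Data.List.Membership.Propositional.Properties using (∈-filter⁺; ∈-filter⁻)
import Data.List.Relation.Unary.Unique.Propositional.Properties as Unique
open import Data.Product using (_×_; _,_; proj₂)
open import Data.Sum using (_⊎_; inj₁; inj₂)
open import Function using (_⇔_; mk⇔; Equivalence; _∘_)
import Function.Properties.Equivalence as ⇔
open import Relation.Nullary using (yes; no; contradiction)
open import Relation.Binary.PropositionalEquality

open Equivalence using (to; from)

valueAt : ∀ {m} → Map m → ℕ → ℕ
valueAt {m} π i with i ℕ.<? m
... | yes i<m = toℕ (lookup π (fromℕ< i<m))
... | no  _   = 0

valueAt-toℕ : ∀ {m} (π : Map m) (j : Fin m) → valueAt π (toℕ j) ≡ toℕ (lookup π j)
valueAt-toℕ {m} π j with toℕ j ℕ.<? m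
... | yes j<m = cong (toℕ ∘ lookup π) (fromℕ<-toℕ j j<m)
... | no  j≮m = contradiction (toℕ<n j) j≮m

openerBit : ∀ {m} → Map m → ℕ → Bool
openerBit π i = i <ᵇ valueAt π i

openerBit⇔opener : ∀ {m} (π : Map m) j → openerBit π (toℕ j) ≡ true ⇔ Opener π j
openerBit⇔opener π j = mk⇔
  (λ bit≡true → subst (toℕ j ℕ.<_) (valueAt-toℕ π j) (ℕ.<ᵇ⇒< _ _ (from T-≡ bit≡true)))
  (λ j<πj → to T-≡ (ℕ.<⇒<ᵇ (subst (toℕ j ℕ.<_) (sym (valueAt-toℕ π j)) j<πj)))

module Bijection (n : ℕ) where

  m : ℕ
  m = 2 * n

  m≡n+n : m ≡ n ℕ.+ n
  m≡n+n = cong (n ℕ.+_) (ℕ.+-identityʳ n)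

  encode : Vec Bool n → Map m
  encode c = Path.encode n c m m≡n+n

  decode : Map m → Vec Bool n
  decode π = fromBits (openerBit π) n

  opener⇔bit : ∀ c (y : Fin m) → toℕ y ℕ.< n → Opener (encode c) y ⇔ bit c (toℕ y) ≡ true
  opener⇔bit c y y<n = ⇔.trans (encode-opener⇔up y) (up⇔bit y<n)
    where open Path n c m m≡n+n using (encode-opener⇔up; up⇔bit)

  decode∘encode : ∀ c → decode (encode c) ≡ c
  decode∘encode c = fromBits-bit (openerBit (encode c)) c openerBit≡bit
    where
    openerBit≡bit : ∀ i → i ℕ.< n → openerBit (encode c) i ≡ bit c i
    openerBit≡bit i i<n = subst (λ k → openerBit (encode c) k ≡ bit c k) (toℕ-fromℕ< i<m)
      (⇔→≡ (⇔.trans (openerBit⇔opener (encode c) j) (opener⇔bit c j (subst (ℕ._< n) (sym (toℕ-fromℕ< i<m)) i<n))))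
      where
      i<m = ℕ.<-≤-trans i<n (ℕ.m≤n*m n 2)
      j = fromℕ< i<m

  toℕ<n⊎opposite<n : ∀ (y : Fin m) → toℕ y ℕ.< n ⊎ toℕ (opposite y) ℕ.< n
  toℕ<n⊎opposite<n y with toℕ y ℕ.<? n
  ... | yes y<n = inj₁ y<n
  ... | no  y≮n = inj₂ (subst (ℕ._< n) (sym (opposite-prop y))
                       (Reflection.n≤i⇒m∸1+i<n n m m≡n+n (ℕ.≮⇒≥ y≮n) (toℕ<n y)))

  encode∘decode : ∀ π → IsCInv321 π → encode (decode π) ≡ π
  encode∘decode π πC = centrosymmetric-same-openers⇒≡ n (Path.encode-CInv321 n (decode π) m m≡n+n) πC toℕ<n⊎opposite<n same
    where
    same : SameOpenersBelow n (encode (decode π)) π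
    same y y<n = ⇔.trans (opener⇔bit (decode π) y y<n)
      (subst (λ b → b ≡ true ⇔ Opener π y) (sym (bit-fromBits (openerBit π) n y<n)) (openerBit⇔opener π y))

  maj⁺-encode : ∀ c → maj⁺ (encode c) ≡ majWord c
  maj⁺-encode c = trans (cong (λ k → sum (filter (isDescent? (encode c)) (range1 k))) m/2≡n)
    (sum-filter-range1 (isDescent? (encode c)) (λ k → bit c k ∧ not (bit c (suc k))) n
      (λ k 1+k≤n → ⇔.trans (encode-descent⇔ (1+i≤n⇒1+i<m 1+k≤n))
                    (⇔.trans (descent⇔up-then-¬up (1+i≤n⇒1+i<m 1+k≤n)) (up-then-¬up⇔bits 1+k≤n))))
    where
    open Path n c m m≡n+n using (encode-descent⇔; descent⇔up-then-¬up; up-then-¬up⇔bits)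
    open Reflection n m m≡n+n using (1+i≤n⇒1+i<m)
    m/2≡n : m / 2 ≡ n
    m/2≡n = trans (cong (_/ 2) (ℕ.*-comm 2 n)) (m*n/n≡m n 2)

  module _ (q : ℤ) where
    open GeneratingFunction q

    CInv321-sum≡wordSum : sumℤ (map (λ π → q ^ℤ maj⁺ π) (CInv321 m)) ≡ wordSum n majWord
    CInv321-sum≡wordSum = trans
      (sumℤ-map-bijection (λ π → q ^ℤ maj⁺ π) decode encode
        (Unique.filter⁺ isCInv321? (allVecs-unique m m)) (allWords-unique n) ∈-allWords
        (λ c → ∈-filter⁺ isCInv321? (∈-allVecs (encode c)) (Path.encode-CInv321 n c m m≡n+n))
        (λ π∈ → encode∘decode _ (proj₂ (∈-filter⁻ isCInv321? {xs = allVecs m m} π∈)))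
        decode∘encode)
      (wordSum-cong n maj⁺-encode)

maj⁺-generatingFunction : ∀ n q →
  sumℤ (map (λ π → q ^ℤ maj⁺ π) (CInv321 (2 * n))) ≡ Σ[0to n ] (λ h → q ^ℤ (n ∸ h) *ℤ qbinom q n h)
maj⁺-generatingFunction n q = begin
  sumℤ (map (λ π → q ^ℤ maj⁺ π) (CInv321 (2 * n)))  ≡⟨ Bijection.CInv321-sum≡wordSum n q ⟩
  GeneratingFunction.wordSum q n majWord            ≡⟨ GeneratingFunction.wordSum-majWord q n ⟩
  QBinomial.descendingSum q n                       ≡⟨ Σ[0to]≡∑< n (λ h → q ^ℤ (n ∸ h) *ℤ qbinom q n h) ⟨
  Σ[0to n ] (λ h → q ^ℤ (n ∸ h) *ℤ qbinom q n h)    ∎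
  where open ≡-Reasoning

qbinomSum-identity : ∀ n q →
  Σ[0to n ] (qbinom q n) + (q ^ℤ n - 1ℤ) *ℤ Σ[0to n ∸ 1 ] (qbinom q (n ∸ 1))
    ≡ Σ[0to n ] (λ h → q ^ℤ (n ∸ h) *ℤ qbinom q n h)
qbinomSum-identity n q = begin
  Σ[0to n ] (qbinom q n) + (q ^ℤ n - 1ℤ) *ℤ Σ[0to n ∸ 1 ] (qbinom q (n ∸ 1))
    ≡⟨ cong₂ (λ a b → a + (q ^ℤ n - 1ℤ) *ℤ b) (Σ[0to]≡∑< n (qbinom q n)) (Σ[0to]≡∑< (n ∸ 1) (qbinom q (n ∸ 1))) ⟩
  binomialSum n + (q ^ℤ n - 1ℤ) *ℤ binomialSum (n ∸ 1)
    ≡⟨ binomialSum-identity n ⟩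
  descendingSum n
    ≡⟨ Σ[0to]≡∑< n (λ h → q ^ℤ (n ∸ h) *ℤ qbinom q n h) ⟨
  Σ[0to n ] (λ h → q ^ℤ (n ∸ h) *ℤ qbinom q n h)
    ∎
  where
  open QBinomial q
  open ≡-Reasoning

theorem3p2 : (n : ℕ) → 1 ≤ n → (q : ℤ) →
    (foldr _+_ 0ℤ (map (λ π → q ^ℤ maj⁺ π) (CInv321 (2 * n)))
      ≡ Σ[0to n ] (λ h → qbinom q n h)
        + (q ^ℤ n - 1ℤ) *ℤ Σ[0to n ∸ 1 ] (λ h → qbinom q (n ∸ 1) h))
    × (Σ[0to n ] (λ h → qbinom q n h)
        + (q ^ℤ n - 1ℤ) *ℤ Σ[0to n ∸ 1 ] (λ h → qbinom q (n ∸ 1) h)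
      ≡ Σ[0to n ] (λ h → q ^ℤ (n ∸ h) *ℤ qbinom q n h))
theorem3p2 n _ q =
  trans (maj⁺-generatingFunction n q) (sym (qbinomSum-identity n q)) , qbinomSum-identity n q
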